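{- Let $k\ge1$ and let $\omega=(\omega_1,\ldots,\omega_k)$ be a rational weight vector. For $q\in\mathbb{Q}$ define $H_{k,0,\omega}(t,q)=1$ and, for $n\ge1$, $$H_{k,n,\omega}(t,q)=\sum_{\alpha\vdash n}\Big(\sum_{j=0}^{|\alpha|-1}\frac{1}{\prod_i\alpha_i!}\binom{|\alpha|-1}{j}B^q_{ -(j)}\,D_{(|\alpha|-j-1)}(\omega_1^{\alpha_1}\cdots\omega_k^{\alpha_k})\Big)t^\alpha.$$ Then for all $q,q'\in\mathbb{Q}$ and all $n\ge0$, $$\sum_{i=0}^nH_{k,i,\omega}(t,q)\,H_{k,n-i,\omega}(t,q')=H_{k,n,\omega}(t,q+q'),$$ i.e. $H_{\omega}(t,q)*H_{\omega}(t,q')=H_{\omega}(t,q+q')$ for the level product.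
   Context: Let $t_1,\ldots,t_k$ be indeterminates, $t^\alpha=t_1^{\alpha_1}\cdots t_k^{\alpha_k}$ for $\alpha\in\mathbb{Z}_{\ge0}^k$, $|\alpha|=\sum_i\alpha_i$, $\alpha\vdash n$ means $\sum_i i\alpha_i=n$. For $q\in\mathbb{Q}$ and $j\ge0$ let $B^q_{ -(j)}=q(q-1)\cdots(q-j)$. The operators $D_j$ act on polynomials in indeterminates $\omega_1,\ldots,\omega_k$: $D_0=\mathrm{id}$, $D_1=\sum_i\partial/\partial\omega_i$, $D_j=D_1\circ D_{j-1}$; the resulting polynomial is evaluated at the given weight vector. The level product of sequences $(P_n)_{n\ge0},(Q_n)_{n\ge0}$ is $(P*Q)_n=\sum_{i=0}^nP_iQ_{n-i}$. -}

module Defs where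

open import Data.Nat as ℕ using (ℕ; zero; suc; _∸_; _≡ᵇ_; NonZero; _!)
open import Data.Nat.Properties using (m*n≢0; _!≢0)
open import Data.Nat.Combinatorics using (_C_)
open import Data.Integer using (+_)
open import Data.Rational using (ℚ; 0ℚ; 1ℚ; _+_; _*_; _-_; _/_)
open import Data.Vec using (Vec; []; _∷_; zipWith)
open import Data.List using (List; []; _∷_; map; concatMap; upTo; foldr)
open import Data.Product using (_×_; _,_)
open import Data.Bool using (if_then_else_)

ℕtoℚ : ℕ → ℚ
ℕtoℚ n = (+ n) / 1

sumℚ : List ℚ → ℚ
sumℚ = foldr _+_ 0ℚ

_^ℚ_ : ℚ → ℕ → ℚ
x ^ℚ zero = 1ℚ
x ^ℚ suc n = x * (x ^ℚ n)

-- exponent vectors α ∈ ℤ≥0^k (index i ↦ α_{i+1})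
Exp : ℕ → Set
Exp k = Vec ℕ k

size : ∀ {k} → Exp k → ℕ
size [] = 0
size (a ∷ as) = a ℕ.+ size as

weightFrom : ∀ {k} → ℕ → Exp k → ℕ
weightFrom m [] = 0
weightFrom m (a ∷ as) = m ℕ.* a ℕ.+ weightFrom (suc m) as

-- α ⊢ n  iff  weight α ≡ n
weight : ∀ {k} → Exp k → ℕ
weight = weightFrom 1

factProd : ∀ {k} → Exp k → ℕ
factProd [] = 1
factProd (a ∷ as) = a ! ℕ.* factProd as

factProd≢0 : ∀ {k} (α : Exp k) → NonZero (factProd α)
factProd≢0 [] = _
factProd≢0 (a ∷ as) = m*n≢0 (a !) (factProd as) {{a !≢0}} {{factProd≢0 as}}

invFactProd : ∀ {k} → Exp k → ℚ
invFactProd α = ((+ 1) / factProd α) {{factProd≢0 α}}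

-- B^q_{-(j)} = q (q-1) ⋯ (q-j)   (j+1 factors)
B : ℚ → ℕ → ℚ
B q zero = q
B q (suc j) = B q j * (q - ℕtoℚ (suc j))

-- polynomials in ω_1..ω_k with rational coefficients, as lists of terms c·ω^β
PolyW : ℕ → Set
PolyW k = List (ℚ × Exp k)

d1Mon : ∀ {k} → Exp k → List (ℕ × Exp k)
d1Mon [] = []
d1Mon (b ∷ bs) = (b , (b ∸ 1) ∷ bs) ∷ map (λ { (m , β) → (m , b ∷ β) }) (d1Mon bs)

-- D_1 = Σ_i ∂/∂ω_i
D1 : ∀ {k} → PolyW k → PolyW k
D1 = concatMap (λ { (c , β) → map (λ { (m , β') → (c * ℕtoℚ m , β') }) (d1Mon β) })

D : ∀ {k} → ℕ → PolyW k → PolyW k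
D zero p = p
D (suc j) p = D1 (D j p)

monW : ∀ {k} → Vec ℚ k → Exp k → ℚ
monW [] [] = 1ℚ
monW (w ∷ ws) (b ∷ bs) = (w ^ℚ b) * monW ws bs

evalW : ∀ {k} → Vec ℚ k → PolyW k → ℚ
evalW ω p = sumℚ (map (λ { (c , β) → c * monW ω β }) p)

-- polynomials in t_1..t_k with rational coefficients, as coefficient functions α ↦ [t^α]P
PolyT : ℕ → Set
PolyT k = Exp k → ℚ

-- inner coefficient of t^α in H_{k,n,ω}(t,q) for α ⊢ n, n ≥ 1
innerCoeff : ∀ {k} → Vec ℚ k → ℚ → Exp k → ℚ
innerCoeff ω q α =
  sumℚ (map (λ j → invFactProd α * ℕtoℚ ((size α ∸ 1) C j) * B q j
                     * evalW ω (D (size α ∸ j ∸ 1) ((1ℚ , α) ∷ [])))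
            (upTo (size α)))

H : ∀ {k} → Vec ℚ k → ℚ → ℕ → PolyT k
H ω q zero α = if weight α ≡ᵇ 0 then 1ℚ else 0ℚ
H ω q (suc n) α = if weight α ≡ᵇ suc n then innerCoeff ω q α else 0ℚ

below : ∀ {k} → Exp k → List (Exp k)
below [] = [] ∷ []
below (g ∷ gs) = concatMap (λ a → map (a ∷_) (below gs)) (upTo (suc g))

_⊛_ : ∀ {k} → PolyT k → PolyT k → PolyT k
(P ⊛ Q) γ = sumℚ (map (λ α → P α * Q (zipWith _∸_ γ α)) (below γ))

levelProd : ∀ {k} → (ℕ → PolyT k) → (ℕ → PolyT k) → ℕ → PolyT k
levelProd P Q n γ = sumℚ (map (λ i → (P i ⊛ Q (n ∸ i)) γ) (upTo (suc n)))

-- Write q ↓ s = q(q-1)⋯(q-s+1) and s ↑ t = s(s+1)⋯(s+t-1). Since D_r = (∂_1 + ⋯ + ∂_k)^r,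
--   D_r(ω^α)/α! = Σ_{β+γ=α, |β|=r} r!/β! · ω^γ/γ!,
-- and substituting this into the coefficient of t^α, the sum over j collapses to j = |γ| - 1, where
-- C(|α|-1, j) B^q_{-(j)} r! = q ↓ |γ| · |γ| ↑ |β|. Hence H_{k,n,ω}(t,q) is the weight-n part of Σ_α Ĥ(α) t^α,
--   Ĥ(α) = Σ_{x+y=α} a_q(|x|,|y|) ω^x/x! · 1/y!,   a_q(s,t) = q ↓ s · s ↑ t,
-- and as the weight is additive, the level product is the weight-n part of the ordinary product.
-- By the multinomial Vandermonde identity Σ_{x+y=γ} g(|x|,|y|) c^x/x! c^y/y! = (Σ_i C(|γ|,i) g(i,|γ|-i)) c^γ/γ!,
-- the product of two such series has as coefficient function the binomial convolution of a_q and a_{q'} in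
-- both arguments, which is a_{q+q'} by the Chu–Vandermonde identities
-- (q+q') ↓ s = Σ_i C(s,i) (q ↓ i) (q' ↓ (s-i)) and (s+s') ↑ t = Σ_i C(t,i) (s ↑ i) (s' ↑ (t-i)).

module Submission where

open import Defs
open import Data.Nat using (ℕ; _≤_)
open import Data.Rational using (ℚ; _+_)
open import Data.Vec using (Vec)
open import Relation.Binary.PropositionalEquality using (_≡_)

open import Algebra.Bundles using (CommutativeMonoid)
import Algebra.Properties.CommutativeSemigroup as CommSemigroupProperties
open import Data.Bool using (true; false; T; if_then_else_)
open import Data.Empty using (⊥-elim)
import Data.Integer as ℤ
import Data.Integer.Properties as ℤP
open import Data.List using (List; []; _∷_; _++_; map; concatMap; upTo; applyUpTo)
import Data.List.Properties as ListP
open import Data.Nat as ℕ using (zero; suc; _∸_; _<_; _≡ᵇ_; NonZero; _!)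
open import Data.Nat.Combinatorics using (_C_; nCk≡n!/k![n-k]!; k![n∸k]!∣n!; nCk+nC[k+1]≡[n+1]C[k+1]; k>n⇒nCk≡0)
import Data.Nat.Coprimality as Coprime
open import Data.Nat.DivMod using (m/n*n≡m)
import Data.Nat.Properties as ℕP
open import Data.Nat.Tactic.RingSolver using (solve-∀)
open import Data.Product using (_×_; _,_; proj₁; proj₂)
open import Data.Rational using (mkℚ; 0ℚ; 1ℚ; _*_; _-_; _/_)
import Data.Rational.Properties as ℚP
open import Data.Rational.Solver using (module +-*-Solver)
open import Data.Unit using (tt)
open import Data.Vec using ([]; _∷_; zipWith; replicate)
open import Relation.Binary.PropositionalEquality using (refl; sym; trans; cong; cong₂; subst; _≢_; module ≡-Reasoning)
open import Relation.Nullary using (yes; no)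

open ≡-Reasoning
open +-*-Solver using (solve; _:+_; _:*_; _:-_; _:=_)

module ℚ+ = CommSemigroupProperties (CommutativeMonoid.commutativeSemigroup ℚP.+-0-commutativeMonoid)
module ℚ* = CommSemigroupProperties (CommutativeMonoid.commutativeSemigroup ℚP.*-1-commutativeMonoid)

ℕtoℚ≡mkℚ : ∀ n → ℕtoℚ n ≡ mkℚ (ℤ.+ n) 0 (Coprime.sym (Coprime.1-coprimeTo n))
ℕtoℚ≡mkℚ n = ℚP.normalize-coprime (Coprime.sym (Coprime.1-coprimeTo n))

ℕtoℚ-homo-+ : ∀ m n → ℕtoℚ (m ℕ.+ n) ≡ ℕtoℚ m + ℕtoℚ n
ℕtoℚ-homo-+ m n rewrite ℕtoℚ≡mkℚ m | ℕtoℚ≡mkℚ n =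
  cong (_/ 1) (trans (ℤP.pos-+ m n) (sym (cong₂ ℤ._+_ (ℤP.*-identityʳ (ℤ.+ m)) (ℤP.*-identityʳ (ℤ.+ n)))))

ℕtoℚ-homo-* : ∀ m n → ℕtoℚ (m ℕ.* n) ≡ ℕtoℚ m * ℕtoℚ n
ℕtoℚ-homo-* m n rewrite ℕtoℚ≡mkℚ m | ℕtoℚ≡mkℚ n = cong (_/ 1) (ℤP.pos-* m n)

inverse-unique : ∀ a b c → a * b ≡ 1ℚ → a * c ≡ 1ℚ → b ≡ c
inverse-unique a b c ab≡1 ac≡1 = begin
  b             ≡⟨ ℚP.*-identityʳ b ⟨
  b * 1ℚ        ≡⟨ cong (b *_) ac≡1 ⟨
  b * (a * c)   ≡⟨ ℚ*.x∙yz≈yx∙z b a c ⟩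
  (a * b) * c   ≡⟨ cong (_* c) ab≡1 ⟩
  1ℚ * c        ≡⟨ ℚP.*-identityˡ c ⟩
  c             ∎

1/ℕ : (n : ℕ) → .{{NonZero n}} → ℚ
1/ℕ n = (ℤ.+ 1) / n

ℕtoℚ-*-1/ℕ : ∀ n .{{_ : NonZero n}} → ℕtoℚ n * 1/ℕ n ≡ 1ℚ
ℕtoℚ-*-1/ℕ (suc n) rewrite ℕtoℚ≡mkℚ (suc n) | ℚP.normalize-coprime {1} {n} (Coprime.1-coprimeTo (suc n)) =
  ℚP.*-inverseʳ (mkℚ (ℤ.+ suc n) 0 (Coprime.sym (Coprime.1-coprimeTo (suc n))))

1/ℕ-homo-* : ∀ m n .{{_ : NonZero m}} .{{_ : NonZero n}} →
             1/ℕ (m ℕ.* n) {{ℕP.m*n≢0 m n}} ≡ 1/ℕ m * 1/ℕ n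
1/ℕ-homo-* m n = inverse-unique (ℕtoℚ (m ℕ.* n)) _ _ (ℕtoℚ-*-1/ℕ (m ℕ.* n) {{ℕP.m*n≢0 m n}}) (begin
  ℕtoℚ (m ℕ.* n) * (1/ℕ m * 1/ℕ n)             ≡⟨ cong (_* (1/ℕ m * 1/ℕ n)) (ℕtoℚ-homo-* m n) ⟩
  ℕtoℚ m * ℕtoℚ n * (1/ℕ m * 1/ℕ n)            ≡⟨ ℚ*.interchange (ℕtoℚ m) (ℕtoℚ n) (1/ℕ m) (1/ℕ n) ⟩
  (ℕtoℚ m * 1/ℕ m) * (ℕtoℚ n * 1/ℕ n)          ≡⟨ cong₂ _*_ (ℕtoℚ-*-1/ℕ m) (ℕtoℚ-*-1/ℕ n) ⟩
  1ℚ * 1ℚ                                       ≡⟨ ℚP.*-identityˡ 1ℚ ⟩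
  1ℚ                                            ∎)

ℕtoℚ-*-1/ℕ-cancel : ∀ x y z .{{_ : NonZero y}} .{{_ : NonZero z}} → x ℕ.* y ≡ z → ℕtoℚ x * 1/ℕ z ≡ 1/ℕ y
ℕtoℚ-*-1/ℕ-cancel x y z xy≡z = inverse-unique (ℕtoℚ y) _ _ (begin
  ℕtoℚ y * (ℕtoℚ x * 1/ℕ z)    ≡⟨ ℚ*.x∙yz≈yx∙z (ℕtoℚ y) (ℕtoℚ x) (1/ℕ z) ⟩
  ℕtoℚ x * ℕtoℚ y * 1/ℕ z      ≡⟨ cong (_* 1/ℕ z) (trans (sym (ℕtoℚ-homo-* x y)) (cong ℕtoℚ xy≡z)) ⟩
  ℕtoℚ z * 1/ℕ z               ≡⟨ ℕtoℚ-*-1/ℕ z ⟩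
  1ℚ                           ∎) (ℕtoℚ-*-1/ℕ y)

1/! : ℕ → ℚ
1/! n = 1/ℕ (n !) {{n ℕP.!≢0}}

1/!-suc : ∀ n → ℕtoℚ (suc n) * 1/! (suc n) ≡ 1/! n
1/!-suc n = ℕtoℚ-*-1/ℕ-cancel (suc n) (n !) (suc n !) {{n ℕP.!≢0}} {{suc n ℕP.!≢0}} refl

nCk*k!*[n∸k]!≡n! : ∀ {n k} → k ≤ n → (n C k) ℕ.* (k ! ℕ.* (n ∸ k) !) ≡ n !
nCk*k!*[n∸k]!≡n! {n} {k} k≤n =
  trans (cong (ℕ._* (k ! ℕ.* (n ∸ k) !)) (nCk≡n!/k![n-k]! k≤n))
        (m/n*n≡m {{ℕP._!*_!≢0 k (n ∸ k)}} (k![n∸k]!∣n! k≤n))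

[m+n]Cm*m!*n!≡[m+n]! : ∀ m n → ((m ℕ.+ n) C m) ℕ.* (m ! ℕ.* n !) ≡ (m ℕ.+ n) !
[m+n]Cm*m!*n!≡[m+n]! m n =
  subst (λ r → ((m ℕ.+ n) C m) ℕ.* (m ! ℕ.* r !) ≡ (m ℕ.+ n) !) (ℕP.m+n∸m≡n m n)
        (nCk*k!*[n∸k]!≡n! (ℕP.m≤m+n m n))

1/!-*-1/! : ∀ m n → 1/! m * 1/! n ≡ ℕtoℚ ((m ℕ.+ n) C m) * 1/! (m ℕ.+ n)
1/!-*-1/! m n = begin
  1/! m * 1/! n                                   ≡⟨ 1/ℕ-homo-* (m !) (n !) {{m ℕP.!≢0}} {{n ℕP.!≢0}} ⟨
  1/ℕ (m ! ℕ.* n !) {{ℕP._!*_!≢0 m n}}             ≡⟨ ℕtoℚ-*-1/ℕ-cancel ((m ℕ.+ n) C m) (m ! ℕ.* n !) ((m ℕ.+ n) !) {{ℕP._!*_!≢0 m n}} {{(m ℕ.+ n) ℕP.!≢0}}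
                                                       ([m+n]Cm*m!*n!≡[m+n]! m n) ⟨
  ℕtoℚ ((m ℕ.+ n) C m) * 1/! (m ℕ.+ n)            ∎

stepProd : (ℚ → ℕ → ℚ) → ℚ → ℕ → ℚ
stepProd d x zero    = 1ℚ
stepProd d x (suc n) = stepProd d x n * d x n

_↓_ : ℚ → ℕ → ℚ
_↓_ = stepProd (λ x i → x - ℕtoℚ i)

_↑_ : ℚ → ℕ → ℚ
_↑_ = stepProd (λ x i → x + ℕtoℚ i)

B≡↓ : ∀ q j → B q j ≡ q ↓ suc j
B≡↓ q zero    = sym (trans (ℚP.*-identityˡ _) (ℚP.+-identityʳ q))
B≡↓ q (suc j) = cong (_* (q - ℕtoℚ (suc j))) (B≡↓ q j)

0↑suc : ∀ n → 0ℚ ↑ suc n ≡ 0ℚ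
0↑suc zero    = refl
0↑suc (suc n) = trans (cong (_* (0ℚ + ℕtoℚ (suc n))) (0↑suc n)) (ℚP.*-zeroˡ (0ℚ + ℕtoℚ (suc n)))

[m+n]!*1/!m≡[1+m]↑n : ∀ m n → ℕtoℚ ((m ℕ.+ n) !) * 1/! m ≡ ℕtoℚ (suc m) ↑ n
[m+n]!*1/!m≡[1+m]↑n m zero rewrite ℕP.+-identityʳ m = ℕtoℚ-*-1/ℕ (m !) {{m ℕP.!≢0}}
[m+n]!*1/!m≡[1+m]↑n m (suc n) rewrite ℕP.+-suc m n = begin
  ℕtoℚ (suc (m ℕ.+ n) ℕ.* (m ℕ.+ n) !) * 1/! m
    ≡⟨ cong (_* 1/! m) (ℕtoℚ-homo-* (suc m ℕ.+ n) ((m ℕ.+ n) !)) ⟩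
  ℕtoℚ (suc m ℕ.+ n) * ℕtoℚ ((m ℕ.+ n) !) * 1/! m
    ≡⟨ ℚ*.xy∙z≈yz∙x (ℕtoℚ (suc m ℕ.+ n)) _ _ ⟩
  ℕtoℚ ((m ℕ.+ n) !) * 1/! m * ℕtoℚ (suc m ℕ.+ n)
    ≡⟨ cong₂ _*_ ([m+n]!*1/!m≡[1+m]↑n m n) (ℕtoℚ-homo-+ (suc m) n) ⟩
  ℕtoℚ (suc m) ↑ suc n ∎

[m+n]Cm*n!≡[1+m]↑n : ∀ m n → ℕtoℚ ((m ℕ.+ n) C m) * ℕtoℚ (n !) ≡ ℕtoℚ (suc m) ↑ n
[m+n]Cm*n!≡[1+m]↑n m n = begin
  c * ℕtoℚ (n !)                                  ≡⟨ ℚP.*-identityʳ _ ⟨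
  c * ℕtoℚ (n !) * 1ℚ                             ≡⟨ cong (c * ℕtoℚ (n !) *_) (ℕtoℚ-*-1/ℕ (m !) {{m ℕP.!≢0}}) ⟨
  c * ℕtoℚ (n !) * (ℕtoℚ (m !) * 1/! m)           ≡⟨ reassoc c (ℕtoℚ (n !)) (ℕtoℚ (m !)) (1/! m) ⟩
  c * (ℕtoℚ (m !) * ℕtoℚ (n !)) * 1/! m           ≡⟨ cong (λ z → c * z * 1/! m) (ℕtoℚ-homo-* (m !) (n !)) ⟨
  c * ℕtoℚ (m ! ℕ.* n !) * 1/! m                  ≡⟨ cong (_* 1/! m) (ℕtoℚ-homo-* ((m ℕ.+ n) C m) (m ! ℕ.* n !)) ⟨
  ℕtoℚ (((m ℕ.+ n) C m) ℕ.* (m ! ℕ.* n !)) * 1/! m ≡⟨ cong (λ z → ℕtoℚ z * 1/! m) ([m+n]Cm*m!*n!≡[m+n]! m n) ⟩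
  ℕtoℚ ((m ℕ.+ n) !) * 1/! m                      ≡⟨ [m+n]!*1/!m≡[1+m]↑n m n ⟩
  ℕtoℚ (suc m) ↑ n                                ∎
  where
  c = ℕtoℚ ((m ℕ.+ n) C m)
  reassoc : ∀ c a b i → c * a * (b * i) ≡ c * (b * a) * i
  reassoc = solve 4 (λ c a b i → c :* a :* (b :* i) := c :* (b :* a) :* i) refl

δ : ℕ → ℕ → ℚ
δ m n = if m ≡ᵇ n then 1ℚ else 0ℚ

δ-refl : ∀ n → δ n n ≡ 1ℚ
δ-refl zero    = refl
δ-refl (suc n) = δ-refl n

δ-≢ : ∀ {m n} → m ≢ n → δ m n ≡ 0ℚ
δ-≢ {zero}  {zero}  m≢n = ⊥-elim (m≢n refl)
δ-≢ {zero}  {suc n} m≢n = refl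
δ-≢ {suc m} {zero}  m≢n = refl
δ-≢ {suc m} {suc n} m≢n = δ-≢ (λ m≡n → m≢n (cong suc m≡n))

-- Antidiagonal sums and binomial convolution

sumMap : ∀ {A : Set} → (A → ℚ) → List A → ℚ
sumMap f xs = sumℚ (map f xs)

sumMap-cong : ∀ {A : Set} {f g : A → ℚ} xs → (∀ x → f x ≡ g x) → sumMap f xs ≡ sumMap g xs
sumMap-cong []       f≗g = refl
sumMap-cong (x ∷ xs) f≗g = cong₂ _+_ (f≗g x) (sumMap-cong xs f≗g)

sumMap-++ : ∀ {A : Set} (f : A → ℚ) xs ys → sumMap f (xs ++ ys) ≡ sumMap f xs + sumMap f ys
sumMap-++ f []       ys = sym (ℚP.+-identityˡ (sumMap f ys))
sumMap-++ f (x ∷ xs) ys = trans (cong (f x +_) (sumMap-++ f xs ys)) (sym (ℚP.+-assoc (f x) (sumMap f xs) (sumMap f ys)))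

sumMap-concatMap : ∀ {A B : Set} (f : B → ℚ) (g : A → List B) xs →
                   sumMap f (concatMap g xs) ≡ sumMap (λ x → sumMap f (g x)) xs
sumMap-concatMap f g []       = refl
sumMap-concatMap f g (x ∷ xs) = trans (sumMap-++ f (g x) (concatMap g xs)) (cong (sumMap f (g x) +_) (sumMap-concatMap f g xs))

sumMap-map : ∀ {A B : Set} (f : B → ℚ) (g : A → B) xs → sumMap f (map g xs) ≡ sumMap (λ x → f (g x)) xs
sumMap-map f g []       = refl
sumMap-map f g (x ∷ xs) = cong (f (g x) +_) (sumMap-map f g xs)

*-distribˡ-sumMap : ∀ {A : Set} c (f : A → ℚ) xs → c * sumMap f xs ≡ sumMap (λ x → c * f x) xs
*-distribˡ-sumMap c f []       = ℚP.*-zeroʳ c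
*-distribˡ-sumMap c f (x ∷ xs) = trans (ℚP.*-distribˡ-+ c (f x) (sumMap f xs)) (cong (c * f x +_) (*-distribˡ-sumMap c f xs))

Σ₂ : (ℕ → ℕ → ℚ) → ℕ → ℚ
Σ₂ g zero    = g 0 0
Σ₂ g (suc n) = g 0 (suc n) + Σ₂ (λ i → g (suc i)) n

Σ₂-cong-on : ∀ {g h : ℕ → ℕ → ℚ} n → (∀ i j → i ℕ.+ j ≡ n → g i j ≡ h i j) → Σ₂ g n ≡ Σ₂ h n
Σ₂-cong-on zero    g≗h = g≗h 0 0 refl
Σ₂-cong-on (suc n) g≗h = cong₂ _+_ (g≗h 0 (suc n) refl) (Σ₂-cong-on n (λ i j i+j≡n → g≗h (suc i) j (cong suc i+j≡n)))

Σ₂-cong : ∀ {g h : ℕ → ℕ → ℚ} n → (∀ i j → g i j ≡ h i j) → Σ₂ g n ≡ Σ₂ h n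
Σ₂-cong n g≗h = Σ₂-cong-on n (λ i j _ → g≗h i j)

Σ₂-distrib-+ : ∀ (g h : ℕ → ℕ → ℚ) n → Σ₂ (λ i j → g i j + h i j) n ≡ Σ₂ g n + Σ₂ h n
Σ₂-distrib-+ g h zero    = refl
Σ₂-distrib-+ g h (suc n) =
  trans (cong ((g 0 (suc n) + h 0 (suc n)) +_) (Σ₂-distrib-+ (λ i → g (suc i)) (λ i → h (suc i)) n))
        (ℚ+.interchange (g 0 (suc n)) (h 0 (suc n)) _ _)

*-distribˡ-Σ₂ : ∀ c (g : ℕ → ℕ → ℚ) n → c * Σ₂ g n ≡ Σ₂ (λ i j → c * g i j) n
*-distribˡ-Σ₂ c g zero    = refl
*-distribˡ-Σ₂ c g (suc n) = trans (ℚP.*-distribˡ-+ c (g 0 (suc n)) _) (cong (c * g 0 (suc n) +_) (*-distribˡ-Σ₂ c _ n))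

*-distribʳ-Σ₂ : ∀ c (g : ℕ → ℕ → ℚ) n → Σ₂ g n * c ≡ Σ₂ (λ i j → g i j * c) n
*-distribʳ-Σ₂ c g n = trans (ℚP.*-comm (Σ₂ g n) c) (trans (*-distribˡ-Σ₂ c g n) (Σ₂-cong n (λ i j → ℚP.*-comm c (g i j))))

Σ₂-zero : ∀ {g : ℕ → ℕ → ℚ} n → (∀ i j → g i j ≡ 0ℚ) → Σ₂ g n ≡ 0ℚ
Σ₂-zero zero    g≗0 = g≗0 0 0
Σ₂-zero (suc n) g≗0 = trans (cong₂ _+_ (g≗0 0 (suc n)) (Σ₂-zero n (λ i → g≗0 (suc i)))) (ℚP.+-identityˡ 0ℚ)

Σ₂-head : ∀ {g : ℕ → ℕ → ℚ} n → (∀ i j → g (suc i) j ≡ 0ℚ) → Σ₂ g n ≡ g 0 n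
Σ₂-head zero    g≗0 = refl
Σ₂-head {g} (suc n) g≗0 = trans (cong (g 0 (suc n) +_) (Σ₂-zero n g≗0)) (ℚP.+-identityʳ (g 0 (suc n)))

Σ₂-last : ∀ (g : ℕ → ℕ → ℚ) n → Σ₂ g (suc n) ≡ Σ₂ (λ i j → g i (suc j)) n + g (suc n) 0
Σ₂-last g zero    = refl
Σ₂-last g (suc n) =
  trans (cong (g 0 (suc (suc n)) +_) (Σ₂-last (λ i → g (suc i)) n))
        (sym (ℚP.+-assoc (g 0 (suc (suc n))) (Σ₂ (λ i j → g (suc i) (suc j)) n) (g (suc (suc n)) 0)))

Σ₂-swap : ∀ (g : ℕ → ℕ → ℚ) n → Σ₂ g n ≡ Σ₂ (λ i j → g j i) n
Σ₂-swap g zero    = refl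
Σ₂-swap g (suc n) =
  trans (cong (g 0 (suc n) +_) (Σ₂-swap _ n))
        (trans (ℚP.+-comm (g 0 (suc n)) _) (sym (Σ₂-last (λ i j → g j i) n)))

Σ₂-assoc : ∀ (f : ℕ → ℕ → ℕ → ℚ) n →
           Σ₂ (λ m k → Σ₂ (λ i j → f i j k) m) n ≡ Σ₂ (λ i m → Σ₂ (λ j k → f i j k) m) n
Σ₂-assoc f zero    = refl
Σ₂-assoc f (suc n) =
  trans (cong (f 0 0 (suc n) +_)
          (trans (Σ₂-distrib-+ (λ m k → f 0 (suc m) k) (λ m k → Σ₂ (λ i j → f (suc i) j k) m) n)
                 (cong (Σ₂ (λ m k → f 0 (suc m) k) n +_) (Σ₂-assoc (λ i → f (suc i)) n))))
        (sym (ℚP.+-assoc (f 0 0 (suc n)) (Σ₂ (λ m k → f 0 (suc m) k) n) (Σ₂ (λ i m → Σ₂ (λ j k → f (suc i) j k) m) n)))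

sumMap-upTo≡Σ₂ : ∀ (g : ℕ → ℕ → ℚ) n → sumMap (λ i → g i (n ∸ i)) (upTo (suc n)) ≡ Σ₂ g n
sumMap-upTo≡Σ₂ g n = trans (cong sumℚ (ListP.map-applyUpTo (λ i → i) (λ i → g i (n ∸ i)) (suc n))) (sum-applyUpTo g n)
  where
  sum-applyUpTo : ∀ (g : ℕ → ℕ → ℚ) n → sumℚ (applyUpTo (λ i → g i (n ∸ i)) (suc n)) ≡ Σ₂ g n
  sum-applyUpTo g zero    = ℚP.+-identityʳ (g 0 0)
  sum-applyUpTo g (suc n) = cong (g 0 (suc n) +_) (sum-applyUpTo (λ i → g (suc i)) n)

binomConv : (ℕ → ℕ → ℚ) → ℕ → ℚ
binomConv G n = Σ₂ (λ i j → ℕtoℚ (n C i) * G i j) n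

binomConv-cong-on : ∀ {G H : ℕ → ℕ → ℚ} n → (∀ i j → i ℕ.+ j ≡ n → G i j ≡ H i j) → binomConv G n ≡ binomConv H n
binomConv-cong-on n G≗H = Σ₂-cong-on n (λ i j i+j≡n → cong (ℕtoℚ (n C i) *_) (G≗H i j i+j≡n))

*-distribʳ-binomConv : ∀ c (G : ℕ → ℕ → ℚ) n → binomConv G n * c ≡ binomConv (λ i j → G i j * c) n
*-distribʳ-binomConv c G n =
  trans (*-distribʳ-Σ₂ c (λ i j → ℕtoℚ (n C i) * G i j) n) (Σ₂-cong n (λ i j → ℚP.*-assoc (ℕtoℚ (n C i)) (G i j) c))

binomConv-suc : ∀ (G : ℕ → ℕ → ℚ) n →
                binomConv G (suc n) ≡ binomConv (λ i j → G (suc i) j) n + binomConv (λ i j → G i (suc j)) n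
binomConv-suc G n = begin
  g₀ + Σ₂ (λ i j → ℕtoℚ (suc n C suc i) * G (suc i) j) n
    ≡⟨ cong (g₀ +_) (trans (Σ₂-cong n pascal) (Σ₂-distrib-+ _ _ n)) ⟩
  g₀ + (binomConv (λ i j → G (suc i) j) n + Σ₂ (λ i j → ℕtoℚ (n C suc i) * G (suc i) j) n)
    ≡⟨ ℚ+.x∙yz≈y∙xz g₀ (binomConv (λ i j → G (suc i) j) n) (Σ₂ (λ i j → ℕtoℚ (n C suc i) * G (suc i) j) n) ⟩
  binomConv (λ i j → G (suc i) j) n + Σ₂ (λ i j → ℕtoℚ (n C i) * G i j) (suc n)
    ≡⟨ cong (binomConv (λ i j → G (suc i) j) n +_) (Σ₂-last (λ i j → ℕtoℚ (n C i) * G i j) n) ⟩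
  binomConv (λ i j → G (suc i) j) n + (binomConv (λ i j → G i (suc j)) n + ℕtoℚ (n C suc n) * G (suc n) 0)
    ≡⟨ cong (λ c → binomConv (λ i j → G (suc i) j) n + (binomConv (λ i j → G i (suc j)) n + ℕtoℚ c * G (suc n) 0))
            (k>n⇒nCk≡0 (ℕP.n<1+n n)) ⟩
  binomConv (λ i j → G (suc i) j) n + (binomConv (λ i j → G i (suc j)) n + 0ℚ * G (suc n) 0)
    ≡⟨ cong (binomConv (λ i j → G (suc i) j) n +_)
            (trans (cong (binomConv (λ i j → G i (suc j)) n +_) (ℚP.*-zeroˡ (G (suc n) 0))) (ℚP.+-identityʳ _)) ⟩
  binomConv (λ i j → G (suc i) j) n + binomConv (λ i j → G i (suc j)) n ∎
  where
  -- suc n C 0 and n C 0 both compute to 1, so g₀ is also the first term of the sum over suc n in the third line.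
  g₀ = ℕtoℚ (suc n C 0) * G 0 (suc n)
  pascal : ∀ i j → ℕtoℚ (suc n C suc i) * G (suc i) j ≡ ℕtoℚ (n C i) * G (suc i) j + ℕtoℚ (n C suc i) * G (suc i) j
  pascal i j = trans (cong (λ c → ℕtoℚ c * G (suc i) j) (sym (nCk+nC[k+1]≡[n+1]C[k+1] n i)))
                     (trans (cong (_* G (suc i) j) (ℕtoℚ-homo-+ (n C i) (n C suc i))) (ℚP.*-distribʳ-+ (G (suc i) j) (ℕtoℚ (n C i)) (ℕtoℚ (n C suc i))))

binomConv-vandermonde : ∀ (G : ℕ → ℕ → ℚ) a m →
  binomConv (λ i j → binomConv (λ s t → G (i ℕ.+ s) (j ℕ.+ t)) m) a ≡ binomConv G (a ℕ.+ m)
binomConv-vandermonde G zero    m = ℚP.*-identityˡ _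
binomConv-vandermonde G (suc a) m =
  trans (binomConv-suc (λ i j → binomConv (λ s t → G (i ℕ.+ s) (j ℕ.+ t)) m) a)
        (trans (cong₂ _+_ (binomConv-vandermonde (λ u v → G (suc u) v) a m) (binomConv-vandermonde (λ u v → G u (suc v)) a m))
               (sym (binomConv-suc G (a ℕ.+ m))))

stepProd-binomial : ∀ (d : ℚ → ℕ → ℚ) → (∀ x y i j → d x i + d y j ≡ d (x + y) (i ℕ.+ j)) →
  ∀ n x y → binomConv (λ i j → stepProd d x i * stepProd d y j) n ≡ stepProd d (x + y) n
stepProd-binomial d d-additive zero    x y = trans (ℚP.*-identityˡ _) (ℚP.*-identityˡ 1ℚ)
stepProd-binomial d d-additive (suc n) x y = sym (begin
  P (x + y) n * d (x + y) n
    ≡⟨ cong (_* d (x + y) n) (stepProd-binomial d d-additive n x y) ⟨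
  binomConv (λ i j → P x i * P y j) n * d (x + y) n
    ≡⟨ *-distribʳ-binomConv (d (x + y) n) _ n ⟩
  binomConv (λ i j → P x i * P y j * d (x + y) n) n
    ≡⟨ binomConv-cong-on n (λ i j i+j≡n →
         trans (cong (λ z → P x i * P y j * z) (trans (sym (cong (d (x + y)) i+j≡n)) (sym (d-additive x y i j))))
               (distrib (P x i) (P y j) (d x i) (d y j))) ⟩
  binomConv (λ i j → P x (suc i) * P y j + P x i * P y (suc j)) n
    ≡⟨ Σ₂-cong n (λ i j → ℚP.*-distribˡ-+ (ℕtoℚ (n C i)) _ _) ⟩
  Σ₂ (λ i j → ℕtoℚ (n C i) * (P x (suc i) * P y j) + ℕtoℚ (n C i) * (P x i * P y (suc j))) n
    ≡⟨ Σ₂-distrib-+ _ _ n ⟩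
  binomConv (λ i j → P x (suc i) * P y j) n + binomConv (λ i j → P x i * P y (suc j)) n
    ≡⟨ binomConv-suc (λ i j → P x i * P y j) n ⟨
  binomConv (λ i j → P x i * P y j) (suc n) ∎)
  where
  P = stepProd d
  distrib : ∀ a b da db → a * b * (da + db) ≡ a * da * b + a * (b * db)
  distrib = solve 4 (λ a b da db → a :* b :* (da :+ db) := a :* da :* b :+ a :* (b :* db)) refl

↓-binomial : ∀ n x y → binomConv (λ i j → x ↓ i * y ↓ j) n ≡ (x + y) ↓ n
↓-binomial = stepProd-binomial _ (λ x y i j → trans (rearrange x y (ℕtoℚ i) (ℕtoℚ j)) (cong ((x + y) -_) (sym (ℕtoℚ-homo-+ i j))))
  where
  rearrange : ∀ x y a b → (x - a) + (y - b) ≡ (x + y) - (a + b)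
  rearrange = solve 4 (λ x y a b → (x :- a) :+ (y :- b) := (x :+ y) :- (a :+ b)) refl

↑-binomial : ∀ n x y → binomConv (λ i j → x ↑ i * y ↑ j) n ≡ (x + y) ↑ n
↑-binomial = stepProd-binomial _ (λ x y i j → trans (rearrange x y (ℕtoℚ i) (ℕtoℚ j)) (cong ((x + y) +_) (sym (ℕtoℚ-homo-+ i j))))
  where
  rearrange : ∀ x y a b → (x + a) + (y + b) ≡ (x + y) + (a + b)
  rearrange = solve 4 (λ x y a b → (x :+ a) :+ (y :+ b) := (x :+ y) :+ (a :+ b)) refl

Σ₂ᵛ : ∀ {k} → (Exp k → Exp k → ℚ) → Exp k → ℚ
Σ₂ᵛ f []      = f [] []
Σ₂ᵛ f (a ∷ α) = Σ₂ (λ i j → Σ₂ᵛ (λ x y → f (i ∷ x) (j ∷ y)) α) a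

Σ₂ᵛ-cong-on : ∀ {k} {f g : Exp k → Exp k → ℚ} α →
              (∀ x y → zipWith ℕ._+_ x y ≡ α → f x y ≡ g x y) → Σ₂ᵛ f α ≡ Σ₂ᵛ g α
Σ₂ᵛ-cong-on []      f≗g = f≗g [] [] refl
Σ₂ᵛ-cong-on (a ∷ α) f≗g =
  Σ₂-cong-on a (λ i j i+j≡a → Σ₂ᵛ-cong-on α (λ x y x+y≡α → f≗g (i ∷ x) (j ∷ y) (cong₂ _∷_ i+j≡a x+y≡α)))

Σ₂ᵛ-cong : ∀ {k} {f g : Exp k → Exp k → ℚ} α → (∀ x y → f x y ≡ g x y) → Σ₂ᵛ f α ≡ Σ₂ᵛ g α
Σ₂ᵛ-cong α f≗g = Σ₂ᵛ-cong-on α (λ x y _ → f≗g x y)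

Σ₂ᵛ-distrib-+ : ∀ {k} (f g : Exp k → Exp k → ℚ) α → Σ₂ᵛ (λ x y → f x y + g x y) α ≡ Σ₂ᵛ f α + Σ₂ᵛ g α
Σ₂ᵛ-distrib-+ f g []      = refl
Σ₂ᵛ-distrib-+ f g (a ∷ α) =
  trans (Σ₂-cong a (λ i j → Σ₂ᵛ-distrib-+ (λ x y → f (i ∷ x) (j ∷ y)) (λ x y → g (i ∷ x) (j ∷ y)) α))
        (Σ₂-distrib-+ (λ i j → Σ₂ᵛ (λ x y → f (i ∷ x) (j ∷ y)) α) (λ i j → Σ₂ᵛ (λ x y → g (i ∷ x) (j ∷ y)) α) a)

*-distribˡ-Σ₂ᵛ : ∀ {k} c (f : Exp k → Exp k → ℚ) α → c * Σ₂ᵛ f α ≡ Σ₂ᵛ (λ x y → c * f x y) α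
*-distribˡ-Σ₂ᵛ c f []      = refl
*-distribˡ-Σ₂ᵛ c f (a ∷ α) =
  trans (*-distribˡ-Σ₂ c (λ i j → Σ₂ᵛ (λ x y → f (i ∷ x) (j ∷ y)) α) a)
        (Σ₂-cong a (λ i j → *-distribˡ-Σ₂ᵛ c (λ x y → f (i ∷ x) (j ∷ y)) α))

*-distribʳ-Σ₂ᵛ : ∀ {k} c (f : Exp k → Exp k → ℚ) α → Σ₂ᵛ f α * c ≡ Σ₂ᵛ (λ x y → f x y * c) α
*-distribʳ-Σ₂ᵛ c f α = trans (ℚP.*-comm (Σ₂ᵛ f α) c) (trans (*-distribˡ-Σ₂ᵛ c f α) (Σ₂ᵛ-cong α (λ x y → ℚP.*-comm c (f x y))))

Σ₂ᵛ-zero : ∀ {k} {f : Exp k → Exp k → ℚ} α → (∀ x y → f x y ≡ 0ℚ) → Σ₂ᵛ f α ≡ 0ℚ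
Σ₂ᵛ-zero []      f≗0 = f≗0 [] []
Σ₂ᵛ-zero (a ∷ α) f≗0 = Σ₂-zero a (λ i j → Σ₂ᵛ-zero α (λ x y → f≗0 (i ∷ x) (j ∷ y)))

Σ₂ᵛ-Σ₂ : ∀ {k} (F : ℕ → ℕ → Exp k → Exp k → ℚ) n α →
         Σ₂ᵛ (λ x y → Σ₂ (λ i j → F i j x y) n) α ≡ Σ₂ (λ i j → Σ₂ᵛ (F i j) α) n
Σ₂ᵛ-Σ₂ F zero    α = refl
Σ₂ᵛ-Σ₂ F (suc n) α =
  trans (Σ₂ᵛ-distrib-+ (F 0 (suc n)) (λ x y → Σ₂ (λ i j → F (suc i) j x y) n) α)
        (cong (Σ₂ᵛ (F 0 (suc n)) α +_) (Σ₂ᵛ-Σ₂ (λ i → F (suc i)) n α))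

Σ₂ᵛ-swap : ∀ {k} (f : Exp k → Exp k → ℚ) α → Σ₂ᵛ f α ≡ Σ₂ᵛ (λ x y → f y x) α
Σ₂ᵛ-swap f []      = refl
Σ₂ᵛ-swap f (a ∷ α) =
  trans (Σ₂-cong a (λ i j → Σ₂ᵛ-swap (λ x y → f (i ∷ x) (j ∷ y)) α))
        (Σ₂-swap (λ i j → Σ₂ᵛ (λ x y → f (i ∷ y) (j ∷ x)) α) a)

Σ₂ᵛ-assoc : ∀ {k} (f : Exp k → Exp k → Exp k → ℚ) α →
            Σ₂ᵛ (λ z w → Σ₂ᵛ (λ x y → f x y w) z) α ≡ Σ₂ᵛ (λ x z → Σ₂ᵛ (λ y w → f x y w) z) α
Σ₂ᵛ-assoc f []      = refl
Σ₂ᵛ-assoc f (a ∷ α) = begin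
  Σ₂ (λ m l → Σ₂ᵛ (λ z w → Σ₂ (λ i j → Σ₂ᵛ (λ x y → f (i ∷ x) (j ∷ y) (l ∷ w)) z) m) α) a
    ≡⟨ Σ₂-cong a (λ m l → Σ₂ᵛ-Σ₂ (λ i j z w → Σ₂ᵛ (λ x y → f (i ∷ x) (j ∷ y) (l ∷ w)) z) m α) ⟩
  Σ₂ (λ m l → Σ₂ (λ i j → Σ₂ᵛ (λ z w → Σ₂ᵛ (λ x y → f (i ∷ x) (j ∷ y) (l ∷ w)) z) α) m) a
    ≡⟨ Σ₂-cong a (λ m l → Σ₂-cong m (λ i j → Σ₂ᵛ-assoc (λ x y w → f (i ∷ x) (j ∷ y) (l ∷ w)) α)) ⟩
  Σ₂ (λ m l → Σ₂ (λ i j → g i j l) m) a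
    ≡⟨ Σ₂-assoc g a ⟩
  Σ₂ (λ i m → Σ₂ (λ j l → g i j l) m) a
    ≡⟨ Σ₂-cong a (λ i m → Σ₂ᵛ-Σ₂ (λ j l x z → Σ₂ᵛ (λ y w → f (i ∷ x) (j ∷ y) (l ∷ w)) z) m α) ⟨
  Σ₂ (λ i m → Σ₂ᵛ (λ x z → Σ₂ (λ j l → Σ₂ᵛ (λ y w → f (i ∷ x) (j ∷ y) (l ∷ w)) z) m) α) a ∎
  where
  g : ℕ → ℕ → ℕ → ℚ
  g i j l = Σ₂ᵛ (λ x z → Σ₂ᵛ (λ y w → f (i ∷ x) (j ∷ y) (l ∷ w)) z) α

Σ₂ᵛ-interchange : ∀ {k} (f : Exp k → Exp k → Exp k → Exp k → ℚ) α →
  Σ₂ᵛ (λ x y → Σ₂ᵛ (λ x₁ y₁ → Σ₂ᵛ (λ x₂ y₂ → f x₁ y₁ x₂ y₂) y) x) α ≡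
  Σ₂ᵛ (λ x y → Σ₂ᵛ (λ x₁ x₂ → Σ₂ᵛ (λ y₁ y₂ → f x₁ y₁ x₂ y₂) y) x) α
Σ₂ᵛ-interchange f α = begin
  Σ₂ᵛ (λ x y → Σ₂ᵛ (λ x₁ y₁ → Σ₂ᵛ (λ x₂ y₂ → f x₁ y₁ x₂ y₂) y) x) α
    ≡⟨ Σ₂ᵛ-assoc (λ x₁ y₁ y → Σ₂ᵛ (λ x₂ y₂ → f x₁ y₁ x₂ y₂) y) α ⟩
  Σ₂ᵛ (λ x₁ z → Σ₂ᵛ (λ y₁ y → Σ₂ᵛ (λ x₂ y₂ → f x₁ y₁ x₂ y₂) y) z) α
    ≡⟨ Σ₂ᵛ-cong α (λ x₁ z → swap-middle (f x₁) z) ⟩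
  Σ₂ᵛ (λ x₁ z → Σ₂ᵛ (λ x₂ y → Σ₂ᵛ (λ y₁ y₂ → f x₁ y₁ x₂ y₂) y) z) α
    ≡⟨ Σ₂ᵛ-assoc (λ x₁ x₂ y → Σ₂ᵛ (λ y₁ y₂ → f x₁ y₁ x₂ y₂) y) α ⟨
  Σ₂ᵛ (λ x y → Σ₂ᵛ (λ x₁ x₂ → Σ₂ᵛ (λ y₁ y₂ → f x₁ y₁ x₂ y₂) y) x) α ∎
  where
  swap-middle : ∀ (g : Exp _ → Exp _ → Exp _ → ℚ) z →
    Σ₂ᵛ (λ y₁ y → Σ₂ᵛ (λ x₂ y₂ → g y₁ x₂ y₂) y) z ≡ Σ₂ᵛ (λ x₂ y → Σ₂ᵛ (λ y₁ y₂ → g y₁ x₂ y₂) y) z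
  swap-middle g z =
    trans (sym (Σ₂ᵛ-assoc g z))
          (trans (Σ₂ᵛ-cong z (λ w y₂ → Σ₂ᵛ-swap (λ y₁ x₂ → g y₁ x₂ y₂) w)) (Σ₂ᵛ-assoc (λ x₂ y₁ y₂ → g y₁ x₂ y₂) z))

Σ₂ᵛ-*-Σ₂ᵛ : ∀ {k} (f g : Exp k → Exp k → ℚ) α β →
            Σ₂ᵛ f α * Σ₂ᵛ g β ≡ Σ₂ᵛ (λ x₁ y₁ → Σ₂ᵛ (λ x₂ y₂ → f x₁ y₁ * g x₂ y₂) β) α
Σ₂ᵛ-*-Σ₂ᵛ f g α β = trans (*-distribʳ-Σ₂ᵛ (Σ₂ᵛ g β) f α) (Σ₂ᵛ-cong α (λ x₁ y₁ → *-distribˡ-Σ₂ᵛ (f x₁ y₁) g β))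

Σ₂ᵛ-δ-unit : ∀ {k} (h : Exp k → Exp k → ℚ) α → Σ₂ᵛ (λ x y → δ (size x) 0 * h x y) α ≡ h (replicate _ 0) α
Σ₂ᵛ-δ-unit h []          = ℚP.*-identityˡ (h [] [])
Σ₂ᵛ-δ-unit h (zero ∷ α)  = Σ₂ᵛ-δ-unit (λ x y → h (0 ∷ x) (0 ∷ y)) α
Σ₂ᵛ-δ-unit h (suc a ∷ α) =
  trans (cong (_+ Σ₂ (λ i j → Σ₂ᵛ (λ x y → δ (suc i ℕ.+ size x) 0 * h (suc i ∷ x) (j ∷ y)) α) a)
              (Σ₂ᵛ-δ-unit (λ x y → h (0 ∷ x) (suc a ∷ y)) α))
        (trans (cong (h (0 ∷ replicate _ 0) (suc a ∷ α) +_) (Σ₂-zero a (λ i j → Σ₂ᵛ-zero α (λ x y → ℚP.*-zeroˡ (h (suc i ∷ x) (j ∷ y))))))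
               (ℚP.+-identityʳ (h (0 ∷ replicate _ 0) (suc a ∷ α))))

Σ₂ᵛ-size0 : ∀ {k} (f : Exp k → Exp k → ℚ) α → size α ≡ 0 → Σ₂ᵛ f α ≡ f α α
Σ₂ᵛ-size0 f []         _      = refl
Σ₂ᵛ-size0 f (zero ∷ α) size≡0 = Σ₂ᵛ-size0 (λ x y → f (0 ∷ x) (0 ∷ y)) α size≡0

size-zipWith-+ : ∀ {k} (x y : Exp k) → size (zipWith ℕ._+_ x y) ≡ size x ℕ.+ size y
size-zipWith-+ []      []      = refl
size-zipWith-+ (i ∷ x) (j ∷ y) = trans (cong ((i ℕ.+ j) ℕ.+_) (size-zipWith-+ x y)) (interchange i j (size x) (size y))
  where
  interchange : ∀ a b c d → (a ℕ.+ b) ℕ.+ (c ℕ.+ d) ≡ (a ℕ.+ c) ℕ.+ (b ℕ.+ d)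
  interchange = solve-∀

weightFrom-zipWith-+ : ∀ {k} m (x y : Exp k) → weightFrom m (zipWith ℕ._+_ x y) ≡ weightFrom m x ℕ.+ weightFrom m y
weightFrom-zipWith-+ m []      []      = refl
weightFrom-zipWith-+ m (i ∷ x) (j ∷ y) =
  trans (cong (m ℕ.* (i ℕ.+ j) ℕ.+_) (weightFrom-zipWith-+ (suc m) x y)) (distrib m i j (weightFrom (suc m) x) (weightFrom (suc m) y))
  where
  distrib : ∀ m a b c d → m ℕ.* (a ℕ.+ b) ℕ.+ (c ℕ.+ d) ≡ (m ℕ.* a ℕ.+ c) ℕ.+ (m ℕ.* b ℕ.+ d)
  distrib = solve-∀

⊛≡Σ₂ᵛ : ∀ {k} (P Q : PolyT k) γ → (P ⊛ Q) γ ≡ Σ₂ᵛ (λ x y → P x * Q y) γ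
⊛≡Σ₂ᵛ P Q γ = below-sum (λ x y → P x * Q y) γ
  where
  below-sum : ∀ {k} (f : Exp k → Exp k → ℚ) γ → sumMap (λ x → f x (zipWith _∸_ γ x)) (below γ) ≡ Σ₂ᵛ f γ
  below-sum f []      = ℚP.+-identityʳ (f [] [])
  below-sum f (a ∷ γ) = begin
    sumMap (λ x → f x (zipWith _∸_ (a ∷ γ) x)) (concatMap (λ i → map (i ∷_) (below γ)) (upTo (suc a)))
      ≡⟨ sumMap-concatMap _ (λ i → map (i ∷_) (below γ)) (upTo (suc a)) ⟩
    sumMap (λ i → sumMap (λ x → f x (zipWith _∸_ (a ∷ γ) x)) (map (i ∷_) (below γ))) (upTo (suc a))
      ≡⟨ sumMap-cong (upTo (suc a)) (λ i → trans (sumMap-map _ (i ∷_) (below γ)) (below-sum (λ x y → f (i ∷ x) ((a ∸ i) ∷ y)) γ)) ⟩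
    sumMap (λ i → Σ₂ᵛ (λ x y → f (i ∷ x) ((a ∸ i) ∷ y)) γ) (upTo (suc a))
      ≡⟨ sumMap-upTo≡Σ₂ (λ i j → Σ₂ᵛ (λ x y → f (i ∷ x) (j ∷ y)) γ) a ⟩
    Σ₂ᵛ f (a ∷ γ) ∎

-- The monomials c^x/x! and the multinomial Vandermonde identity

expMon₁ : ℚ → ℕ → ℚ
expMon₁ c a = c ^ℚ a * 1/! a

expMon : ∀ {k} → Vec ℚ k → Exp k → ℚ
expMon []       []      = 1ℚ
expMon (c ∷ cs) (a ∷ α) = expMon₁ c a * expMon cs α

^ℚ-+ : ∀ c i j → c ^ℚ i * c ^ℚ j ≡ c ^ℚ (i ℕ.+ j)
^ℚ-+ c zero    j = ℚP.*-identityˡ (c ^ℚ j)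
^ℚ-+ c (suc i) j = trans (ℚP.*-assoc c (c ^ℚ i) (c ^ℚ j)) (cong (c *_) (^ℚ-+ c i j))

expMon₁-suc : ∀ c a → ℕtoℚ (suc a) * expMon₁ c (suc a) ≡ c * expMon₁ c a
expMon₁-suc c a = begin
  ℕtoℚ (suc a) * (c * c ^ℚ a * 1/! (suc a))    ≡⟨ ℚ*.x∙yz≈y∙xz (ℕtoℚ (suc a)) (c * c ^ℚ a) (1/! (suc a)) ⟩
  c * c ^ℚ a * (ℕtoℚ (suc a) * 1/! (suc a))    ≡⟨ cong (c * c ^ℚ a *_) (1/!-suc a) ⟩
  c * c ^ℚ a * 1/! a                          ≡⟨ ℚP.*-assoc c (c ^ℚ a) (1/! a) ⟩
  c * expMon₁ c a                             ∎

expMon₁-*-expMon₁ : ∀ c i j → expMon₁ c i * expMon₁ c j ≡ ℕtoℚ ((i ℕ.+ j) C i) * expMon₁ c (i ℕ.+ j)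
expMon₁-*-expMon₁ c i j = begin
  c ^ℚ i * 1/! i * (c ^ℚ j * 1/! j)                           ≡⟨ ℚ*.interchange (c ^ℚ i) (1/! i) (c ^ℚ j) (1/! j) ⟩
  c ^ℚ i * c ^ℚ j * (1/! i * 1/! j)                           ≡⟨ cong₂ _*_ (^ℚ-+ c i j) (1/!-*-1/! i j) ⟩
  c ^ℚ (i ℕ.+ j) * (ℕtoℚ ((i ℕ.+ j) C i) * 1/! (i ℕ.+ j))     ≡⟨ ℚ*.x∙yz≈y∙xz (c ^ℚ (i ℕ.+ j)) (ℕtoℚ ((i ℕ.+ j) C i)) (1/! (i ℕ.+ j)) ⟩
  ℕtoℚ ((i ℕ.+ j) C i) * (c ^ℚ (i ℕ.+ j) * 1/! (i ℕ.+ j))     ∎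

expMon-vandermonde : ∀ {k} (c : Vec ℚ k) (g : ℕ → ℕ → ℚ) γ →
  Σ₂ᵛ (λ x y → g (size x) (size y) * (expMon c x * expMon c y)) γ ≡ binomConv g (size γ) * expMon c γ
expMon-vandermonde []       g []      = trans (cong (g 0 0 *_) (ℚP.*-identityˡ 1ℚ)) (cong (_* 1ℚ) (sym (ℚP.*-identityˡ (g 0 0))))
expMon-vandermonde (c ∷ cs) g (a ∷ γ) = begin
  Σ₂ (λ i j → Σ₂ᵛ (λ x y → g (i ℕ.+ size x) (j ℕ.+ size y) * (expMon (c ∷ cs) (i ∷ x) * expMon (c ∷ cs) (j ∷ y))) γ) a
    ≡⟨ Σ₂-cong a (λ i j → trans (Σ₂ᵛ-cong γ (λ x y → reassoc (g (i ℕ.+ size x) (j ℕ.+ size y)) (expMon₁ c i) (expMon cs x) (expMon₁ c j) (expMon cs y)))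
                          (trans (sym (*-distribˡ-Σ₂ᵛ (expMon₁ c i * expMon₁ c j) (λ x y → g (i ℕ.+ size x) (j ℕ.+ size y) * (expMon cs x * expMon cs y)) γ))
                                 (cong (expMon₁ c i * expMon₁ c j *_) (expMon-vandermonde cs (λ s t → g (i ℕ.+ s) (j ℕ.+ t)) γ)))) ⟩
  Σ₂ (λ i j → expMon₁ c i * expMon₁ c j * (G i j * expMon cs γ)) a
    ≡⟨ Σ₂-cong-on a (λ i j i+j≡a → trans (cong (_* (G i j * expMon cs γ)) (expMon₁-*-expMon₁ c i j))
                                    (trans (ℚ*.interchange (ℕtoℚ ((i ℕ.+ j) C i)) (expMon₁ c (i ℕ.+ j)) (G i j) (expMon cs γ))
                                           (cong (λ n → ℕtoℚ (n C i) * G i j * (expMon₁ c n * expMon cs γ)) i+j≡a))) ⟩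
  Σ₂ (λ i j → ℕtoℚ (a C i) * G i j * (expMon₁ c a * expMon cs γ)) a
    ≡⟨ *-distribʳ-Σ₂ (expMon₁ c a * expMon cs γ) (λ i j → ℕtoℚ (a C i) * G i j) a ⟨
  binomConv G a * (expMon₁ c a * expMon cs γ)
    ≡⟨ cong (_* (expMon₁ c a * expMon cs γ)) (binomConv-vandermonde g a (size γ)) ⟩
  binomConv g (a ℕ.+ size γ) * expMon (c ∷ cs) (a ∷ γ) ∎
  where
  G : ℕ → ℕ → ℚ
  G i j = binomConv (λ s t → g (i ℕ.+ s) (j ℕ.+ t)) (size γ)
  reassoc : ∀ g mx ex my ey → g * (mx * ex * (my * ey)) ≡ mx * my * (g * (ex * ey))
  reassoc = solve 5 (λ g mx ex my ey → g :* (mx :* ex :* (my :* ey)) := mx :* my :* (g :* (ex :* ey))) refl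

Φ : ∀ {k} → Vec ℚ k → Vec ℚ k → (ℕ → ℕ → ℚ) → PolyT k
Φ c d a α = Σ₂ᵛ (λ x y → a (size x) (size y) * (expMon c x * expMon d y)) α

Φ-cong : ∀ {k} (c d : Vec ℚ k) {a b : ℕ → ℕ → ℚ} → (∀ s t → a s t ≡ b s t) → ∀ α → Φ c d a α ≡ Φ c d b α
Φ-cong c d a≗b α = Σ₂ᵛ-cong α (λ x y → cong (_* (expMon c x * expMon d y)) (a≗b (size x) (size y)))

_⋆_ : (ℕ → ℕ → ℚ) → (ℕ → ℕ → ℚ) → ℕ → ℕ → ℚ
(a ⋆ b) s t = binomConv (λ s₁ s₂ → binomConv (λ t₁ t₂ → a s₁ t₁ * b s₂ t₂) t) s

Φ-⊛ : ∀ {k} (c d : Vec ℚ k) (a b : ℕ → ℕ → ℚ) γ → (Φ c d a ⊛ Φ c d b) γ ≡ Φ c d (a ⋆ b) γ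
Φ-⊛ c d a b γ = begin
  (Φ c d a ⊛ Φ c d b) γ
    ≡⟨ ⊛≡Σ₂ᵛ (Φ c d a) (Φ c d b) γ ⟩
  Σ₂ᵛ (λ x y → Φ c d a x * Φ c d b y) γ
    ≡⟨ Σ₂ᵛ-cong γ (λ x y → Σ₂ᵛ-*-Σ₂ᵛ (λ x₁ y₁ → term a x₁ y₁) (λ x₂ y₂ → term b x₂ y₂) x y) ⟩
  Σ₂ᵛ (λ x y → Σ₂ᵛ (λ x₁ y₁ → Σ₂ᵛ (λ x₂ y₂ → term a x₁ y₁ * term b x₂ y₂) y) x) γ
    ≡⟨ Σ₂ᵛ-interchange (λ x₁ y₁ x₂ y₂ → term a x₁ y₁ * term b x₂ y₂) γ ⟩
  Σ₂ᵛ (λ x y → Σ₂ᵛ (λ x₁ x₂ → Σ₂ᵛ (λ y₁ y₂ → term a x₁ y₁ * term b x₂ y₂) y) x) γ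
    ≡⟨ Σ₂ᵛ-cong γ (λ x y → trans (Σ₂ᵛ-cong x (λ x₁ x₂ → sum-d-parts x₁ x₂ y)) (sum-c-parts x y)) ⟩
  Φ c d (a ⋆ b) γ ∎
  where
  term : (ℕ → ℕ → ℚ) → Exp _ → Exp _ → ℚ
  term a x y = a (size x) (size y) * (expMon c x * expMon d y)
  h : ℕ → ℕ → ℕ → ℚ
  h n s₁ s₂ = binomConv (λ t₁ t₂ → a s₁ t₁ * b s₂ t₂) n
  sum-d-parts : ∀ x₁ x₂ y →
    Σ₂ᵛ (λ y₁ y₂ → term a x₁ y₁ * term b x₂ y₂) y ≡ h (size y) (size x₁) (size x₂) * (expMon c x₁ * expMon c x₂) * expMon d y
  sum-d-parts x₁ x₂ y = begin
    Σ₂ᵛ (λ y₁ y₂ → term a x₁ y₁ * term b x₂ y₂) y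
      ≡⟨ Σ₂ᵛ-cong y (λ y₁ y₂ → reassoc (a (size x₁) (size y₁)) (expMon c x₁) (expMon d y₁) (b (size x₂) (size y₂)) (expMon c x₂) (expMon d y₂)) ⟩
    Σ₂ᵛ (λ y₁ y₂ → a (size x₁) (size y₁) * b (size x₂) (size y₂) * (expMon c x₁ * expMon c x₂) * (expMon d y₁ * expMon d y₂)) y
      ≡⟨ expMon-vandermonde d (λ s t → a (size x₁) s * b (size x₂) t * (expMon c x₁ * expMon c x₂)) y ⟩
    binomConv (λ s t → a (size x₁) s * b (size x₂) t * (expMon c x₁ * expMon c x₂)) (size y) * expMon d y
      ≡⟨ cong (_* expMon d y) (*-distribʳ-binomConv (expMon c x₁ * expMon c x₂) (λ s t → a (size x₁) s * b (size x₂) t) (size y)) ⟨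
    h (size y) (size x₁) (size x₂) * (expMon c x₁ * expMon c x₂) * expMon d y ∎
    where
    reassoc : ∀ a₁ c₁ d₁ b₂ c₂ d₂ → a₁ * (c₁ * d₁) * (b₂ * (c₂ * d₂)) ≡ a₁ * b₂ * (c₁ * c₂) * (d₁ * d₂)
    reassoc = solve 6 (λ a₁ c₁ d₁ b₂ c₂ d₂ → a₁ :* (c₁ :* d₁) :* (b₂ :* (c₂ :* d₂)) := a₁ :* b₂ :* (c₁ :* c₂) :* (d₁ :* d₂)) refl
  sum-c-parts : ∀ x y →
    Σ₂ᵛ (λ x₁ x₂ → h (size y) (size x₁) (size x₂) * (expMon c x₁ * expMon c x₂) * expMon d y) x ≡ term (a ⋆ b) x y
  sum-c-parts x y = begin
    Σ₂ᵛ (λ x₁ x₂ → h (size y) (size x₁) (size x₂) * (expMon c x₁ * expMon c x₂) * expMon d y) x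
      ≡⟨ *-distribʳ-Σ₂ᵛ (expMon d y) (λ x₁ x₂ → h (size y) (size x₁) (size x₂) * (expMon c x₁ * expMon c x₂)) x ⟨
    Σ₂ᵛ (λ x₁ x₂ → h (size y) (size x₁) (size x₂) * (expMon c x₁ * expMon c x₂)) x * expMon d y
      ≡⟨ cong (_* expMon d y) (expMon-vandermonde c (h (size y)) x) ⟩
    (a ⋆ b) (size x) (size y) * expMon c x * expMon d y
      ≡⟨ ℚP.*-assoc ((a ⋆ b) (size x) (size y)) (expMon c x) (expMon d y) ⟩
    term (a ⋆ b) x y ∎

hCoeff : ℚ → ℕ → ℕ → ℚ
hCoeff q s t = q ↓ s * ℕtoℚ s ↑ t

hCoeff-⋆ : ∀ q q′ s t → (hCoeff q ⋆ hCoeff q′) s t ≡ hCoeff (q + q′) s t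
hCoeff-⋆ q q′ s t = begin
  binomConv (λ s₁ s₂ → binomConv (λ t₁ t₂ → hCoeff q s₁ t₁ * hCoeff q′ s₂ t₂) t) s
    ≡⟨ binomConv-cong-on s (λ s₁ s₂ s₁+s₂≡s → begin
         binomConv (λ t₁ t₂ → hCoeff q s₁ t₁ * hCoeff q′ s₂ t₂) t
           ≡⟨ Σ₂-cong t (λ t₁ t₂ → cong (ℕtoℚ (t C t₁) *_) (reassoc (q ↓ s₁) (ℕtoℚ s₁ ↑ t₁) (q′ ↓ s₂) (ℕtoℚ s₂ ↑ t₂))) ⟩
         binomConv (λ t₁ t₂ → ℕtoℚ s₁ ↑ t₁ * ℕtoℚ s₂ ↑ t₂ * (q ↓ s₁ * q′ ↓ s₂)) t
           ≡⟨ *-distribʳ-binomConv (q ↓ s₁ * q′ ↓ s₂) (λ t₁ t₂ → ℕtoℚ s₁ ↑ t₁ * ℕtoℚ s₂ ↑ t₂) t ⟨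
         binomConv (λ t₁ t₂ → ℕtoℚ s₁ ↑ t₁ * ℕtoℚ s₂ ↑ t₂) t * (q ↓ s₁ * q′ ↓ s₂)
           ≡⟨ cong (_* (q ↓ s₁ * q′ ↓ s₂)) (↑-binomial t (ℕtoℚ s₁) (ℕtoℚ s₂)) ⟩
         (ℕtoℚ s₁ + ℕtoℚ s₂) ↑ t * (q ↓ s₁ * q′ ↓ s₂)
           ≡⟨ cong (λ z → z ↑ t * (q ↓ s₁ * q′ ↓ s₂)) (trans (sym (ℕtoℚ-homo-+ s₁ s₂)) (cong ℕtoℚ s₁+s₂≡s)) ⟩
         ℕtoℚ s ↑ t * (q ↓ s₁ * q′ ↓ s₂)
           ≡⟨ ℚP.*-comm (ℕtoℚ s ↑ t) (q ↓ s₁ * q′ ↓ s₂) ⟩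
         q ↓ s₁ * q′ ↓ s₂ * ℕtoℚ s ↑ t ∎) ⟩
  binomConv (λ s₁ s₂ → q ↓ s₁ * q′ ↓ s₂ * ℕtoℚ s ↑ t) s
    ≡⟨ *-distribʳ-binomConv (ℕtoℚ s ↑ t) (λ s₁ s₂ → q ↓ s₁ * q′ ↓ s₂) s ⟨
  binomConv (λ s₁ s₂ → q ↓ s₁ * q′ ↓ s₂) s * ℕtoℚ s ↑ t
    ≡⟨ cong (_* ℕtoℚ s ↑ t) (↓-binomial s q q′) ⟩
  hCoeff (q + q′) s t ∎
  where
  reassoc : ∀ a b c d → a * b * (c * d) ≡ b * d * (a * c)
  reassoc = solve 4 (λ a b c d → a :* b :* (c :* d) := b :* d :* (a :* c)) refl

Dmon : ∀ {k} → Vec ℚ k → ℕ → Exp k → ℚ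
Dmon ω r β = evalW ω (D r ((1ℚ , β) ∷ []))

d1Sum : ∀ {k} → (Exp k → ℚ) → Exp k → ℚ
d1Sum f β = sumMap (λ mβ → ℕtoℚ (proj₁ mβ) * f (proj₂ mβ)) (d1Mon β)

D-suc : ∀ {k} r (p : PolyW k) → D r (D1 p) ≡ D (suc r) p
D-suc zero    p = refl
D-suc (suc r) p = cong D1 (D-suc r p)

sumMap-D1 : ∀ {k} (f : Exp k → ℚ) p →
            sumMap (λ cβ → proj₁ cβ * f (proj₂ cβ)) (D1 p) ≡ sumMap (λ cβ → proj₁ cβ * d1Sum f (proj₂ cβ)) p
sumMap-D1 f []            = refl
sumMap-D1 f ((c , β) ∷ p) =
  trans (sumMap-++ term (map _ (d1Mon β)) (D1 p))
        (cong₂ _+_ (trans (sumMap-map term _ (d1Mon β))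
                          (trans (sumMap-cong (d1Mon β) (λ mβ → ℚP.*-assoc c (ℕtoℚ (proj₁ mβ)) (f (proj₂ mβ))))
                                 (sym (*-distribˡ-sumMap c (λ mβ → ℕtoℚ (proj₁ mβ) * f (proj₂ mβ)) (d1Mon β)))))
                   (sumMap-D1 f p))
  where
  term : ℚ × Exp _ → ℚ
  term cβ = proj₁ cβ * f (proj₂ cβ)

module _ {k} (ω : Vec ℚ k) where

  Dmon-zero : ∀ β → Dmon ω 0 β ≡ monW ω β
  Dmon-zero β = trans (ℚP.+-identityʳ (1ℚ * monW ω β)) (ℚP.*-identityˡ (monW ω β))

  mutual
    evalW-D : ∀ r p → evalW ω (D r p) ≡ sumMap (λ cβ → proj₁ cβ * Dmon ω r (proj₂ cβ)) p
    evalW-D zero    p = sumMap-cong p (λ cβ → cong (proj₁ cβ *_) (sym (Dmon-zero (proj₂ cβ))))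
    evalW-D (suc r) p = trans (evalW-D-suc r p) (sumMap-cong p (λ cβ → cong (proj₁ cβ *_) (sym (Dmon-suc r (proj₂ cβ)))))

    evalW-D-suc : ∀ r p → evalW ω (D (suc r) p) ≡ sumMap (λ cβ → proj₁ cβ * d1Sum (Dmon ω r) (proj₂ cβ)) p
    evalW-D-suc r p = trans (cong (evalW ω) (sym (D-suc r p))) (trans (evalW-D r (D1 p)) (sumMap-D1 (Dmon ω r) p))

    Dmon-suc : ∀ r β → Dmon ω (suc r) β ≡ d1Sum (Dmon ω r) β
    Dmon-suc r β = trans (evalW-D-suc r ((1ℚ , β) ∷ [])) (trans (ℚP.+-identityʳ _) (ℚP.*-identityˡ (d1Sum (Dmon ω r) β)))

-- shift P α = Σ_{i : α_i > 0} P (α - e_i)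

shift : ∀ {k} → (Exp k → ℚ) → Exp k → ℚ
shift P []          = 0ℚ
shift P (zero ∷ α)  = shift (λ x → P (0 ∷ x)) α
shift P (suc a ∷ α) = P (a ∷ α) + shift (λ x → P (suc a ∷ x)) α

shift-cong : ∀ {k} {P Q : Exp k → ℚ} α → (∀ x → P x ≡ Q x) → shift P α ≡ shift Q α
shift-cong []          P≗Q = refl
shift-cong (zero ∷ α)  P≗Q = shift-cong α (λ x → P≗Q (0 ∷ x))
shift-cong (suc a ∷ α) P≗Q = cong₂ _+_ (P≗Q (a ∷ α)) (shift-cong α (λ x → P≗Q (suc a ∷ x)))

shift-*-size : ∀ {k} (g : ℕ → ℚ) (P : Exp k → ℚ) α → shift (λ z → g (suc (size z)) * P z) α ≡ g (size α) * shift P α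
shift-*-size g P []          = sym (ℚP.*-zeroʳ (g 0))
shift-*-size g P (zero ∷ α)  = shift-*-size g (λ x → P (0 ∷ x)) α
shift-*-size g P (suc a ∷ α) = begin
  g (suc a ℕ.+ size α) * P (a ∷ α) + shift (λ x → g (suc (suc a ℕ.+ size x)) * P (suc a ∷ x)) α
    ≡⟨ cong (g (suc a ℕ.+ size α) * P (a ∷ α) +_)
            (trans (shift-cong α (λ x → cong (λ n → g (suc n) * P (suc a ∷ x)) (sym (ℕP.+-suc a (size x)))))
                   (shift-*-size (λ n → g (suc a ℕ.+ n)) (λ x → P (suc a ∷ x)) α)) ⟩
  g (suc a ℕ.+ size α) * P (a ∷ α) + g (suc a ℕ.+ size α) * shift (λ x → P (suc a ∷ x)) α
    ≡⟨ ℚP.*-distribˡ-+ (g (suc a ℕ.+ size α)) _ _ ⟨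
  g (suc a ℕ.+ size α) * shift P (suc a ∷ α) ∎

shift-* : ∀ {k} c (P : Exp k → ℚ) α → shift (λ z → c * P z) α ≡ c * shift P α
shift-* c = shift-*-size (λ _ → c)

shift≡Σ₂ᵛ : ∀ {k} (P : Exp k → ℚ) α → shift P α ≡ Σ₂ᵛ (λ x y → δ (size x) 1 * P y) α
shift≡Σ₂ᵛ P []          = sym (ℚP.*-zeroˡ (P []))
shift≡Σ₂ᵛ P (zero ∷ α)  = shift≡Σ₂ᵛ (λ x → P (0 ∷ x)) α
shift≡Σ₂ᵛ P (suc a ∷ α) = begin
  P (a ∷ α) + shift (λ x → P (suc a ∷ x)) α
    ≡⟨ ℚP.+-comm (P (a ∷ α)) _ ⟩
  shift (λ x → P (suc a ∷ x)) α + P (a ∷ α)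
    ≡⟨ cong₂ _+_ (shift≡Σ₂ᵛ (λ x → P (suc a ∷ x)) α) (sym (Σ₂ᵛ-δ-unit (λ x y → P (a ∷ y)) α)) ⟩
  Σ₂ᵛ (λ x y → δ (size x) 1 * P (suc a ∷ y)) α + Σ₂ᵛ (λ x y → δ (size x) 0 * P (a ∷ y)) α
    ≡⟨ cong (Σ₂ᵛ (λ x y → δ (size x) 1 * P (suc a ∷ y)) α +_)
            (sym (Σ₂-head a (λ i j → Σ₂ᵛ-zero α (λ x y → ℚP.*-zeroˡ (P (j ∷ y)))))) ⟩
  Σ₂ᵛ (λ x y → δ (size x) 1 * P y) (suc a ∷ α) ∎

shift-Σ₂ᵛ : ∀ {k} (P Q : Exp k → ℚ) α →
            shift (λ z → Σ₂ᵛ (λ x y → P x * Q y) z) α ≡ Σ₂ᵛ (λ x y → shift P x * Q y) α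
shift-Σ₂ᵛ P Q α = begin
  shift (λ z → Σ₂ᵛ (λ x y → P x * Q y) z) α
    ≡⟨ shift≡Σ₂ᵛ _ α ⟩
  Σ₂ᵛ (λ w z → L w * Σ₂ᵛ (λ x y → P x * Q y) z) α
    ≡⟨ Σ₂ᵛ-cong α (λ w z → trans (*-distribˡ-Σ₂ᵛ (L w) _ z) (Σ₂ᵛ-cong z (λ x y → sym (ℚP.*-assoc (L w) (P x) (Q y))))) ⟩
  Σ₂ᵛ (λ w z → Σ₂ᵛ (λ x y → L w * P x * Q y) z) α
    ≡⟨ Σ₂ᵛ-assoc (λ w x y → L w * P x * Q y) α ⟨
  Σ₂ᵛ (λ v y → Σ₂ᵛ (λ w x → L w * P x * Q y) v) α
    ≡⟨ Σ₂ᵛ-cong α (λ v y → trans (sym (*-distribʳ-Σ₂ᵛ (Q y) (λ w x → L w * P x) v)) (cong (_* Q y) (sym (shift≡Σ₂ᵛ P v)))) ⟩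
  Σ₂ᵛ (λ v y → shift P v * Q y) α ∎
  where
  L : Exp _ → ℚ
  L w = δ (size w) 1

invFactProd-∷ : ∀ {k} a (α : Exp k) → invFactProd (a ∷ α) ≡ 1/! a * invFactProd α
invFactProd-∷ a α = 1/ℕ-homo-* (a !) (factProd α) {{a ℕP.!≢0}} {{factProd≢0 α}}

d1Sum-∷ : ∀ {k} (f : Exp (suc k) → ℚ) b β → d1Sum f (b ∷ β) ≡ ℕtoℚ b * f ((b ∸ 1) ∷ β) + d1Sum (λ x → f (b ∷ x)) β
d1Sum-∷ f b β = cong (ℕtoℚ b * f ((b ∸ 1) ∷ β) +_) (sumMap-map _ _ (d1Mon β))

*-distribʳ-d1Sum : ∀ {k} c (f : Exp k → ℚ) β → d1Sum f β * c ≡ d1Sum (λ x → f x * c) β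
*-distribʳ-d1Sum c f β =
  trans (ℚP.*-comm (d1Sum f β) c)
        (trans (*-distribˡ-sumMap c _ (d1Mon β))
               (sumMap-cong (d1Mon β) (λ mβ → ℚ*.x∙yz≈y∙zx c (ℕtoℚ (proj₁ mβ)) (f (proj₂ mβ)))))

d1Sum-*-invFactProd : ∀ {k} (f : Exp k → ℚ) α → d1Sum f α * invFactProd α ≡ shift (λ β → f β * invFactProd β) α
d1Sum-*-invFactProd f []          = ℚP.*-zeroˡ (invFactProd [])
d1Sum-*-invFactProd f (zero ∷ α)  = begin
  d1Sum f (0 ∷ α) * invFactProd (0 ∷ α)
    ≡⟨ cong₂ _*_ (trans (d1Sum-∷ f 0 α) (trans (cong (_+ d1Sum (λ x → f (0 ∷ x)) α) (ℚP.*-zeroˡ (f (0 ∷ α)))) (ℚP.+-identityˡ (d1Sum (λ x → f (0 ∷ x)) α))))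
                 (trans (invFactProd-∷ 0 α) (ℚP.*-identityˡ (invFactProd α))) ⟩
  d1Sum (λ x → f (0 ∷ x)) α * invFactProd α
    ≡⟨ d1Sum-*-invFactProd (λ x → f (0 ∷ x)) α ⟩
  shift (λ β → f (0 ∷ β) * invFactProd β) α
    ≡⟨ shift-cong α (λ β → cong (f (0 ∷ β) *_) (sym (trans (invFactProd-∷ 0 β) (ℚP.*-identityˡ (invFactProd β))))) ⟩
  shift (λ β → f β * invFactProd β) (0 ∷ α) ∎
d1Sum-*-invFactProd f (suc a ∷ α) = begin
  d1Sum f (suc a ∷ α) * invFactProd (suc a ∷ α)
    ≡⟨ cong₂ _*_ (d1Sum-∷ f (suc a) α) (invFactProd-∷ (suc a) α) ⟩
  (ℕtoℚ (suc a) * f (a ∷ α) + d1Sum f′ α) * (1/! (suc a) * invFactProd α)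
    ≡⟨ distrib (ℕtoℚ (suc a)) (f (a ∷ α)) (d1Sum f′ α) (1/! (suc a)) (invFactProd α) ⟩
  f (a ∷ α) * ((ℕtoℚ (suc a) * 1/! (suc a)) * invFactProd α) + d1Sum f′ α * 1/! (suc a) * invFactProd α
    ≡⟨ cong₂ (λ u v → f (a ∷ α) * (u * invFactProd α) + v * invFactProd α) (1/!-suc a) (*-distribʳ-d1Sum (1/! (suc a)) f′ α) ⟩
  f (a ∷ α) * (1/! a * invFactProd α) + d1Sum (λ x → f′ x * 1/! (suc a)) α * invFactProd α
    ≡⟨ cong₂ _+_ (cong (f (a ∷ α) *_) (sym (invFactProd-∷ a α))) (d1Sum-*-invFactProd (λ x → f′ x * 1/! (suc a)) α) ⟩
  f (a ∷ α) * invFactProd (a ∷ α) + shift (λ β → f′ β * 1/! (suc a) * invFactProd β) α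
    ≡⟨ cong (f (a ∷ α) * invFactProd (a ∷ α) +_)
            (shift-cong α (λ β → trans (ℚP.*-assoc (f′ β) (1/! (suc a)) (invFactProd β)) (cong (f′ β *_) (sym (invFactProd-∷ (suc a) β))))) ⟩
  shift (λ β → f β * invFactProd β) (suc a ∷ α) ∎
  where
  f′ : Exp _ → ℚ
  f′ x = f (suc a ∷ x)
  distrib : ∀ n f s i j → (n * f + s) * (i * j) ≡ f * ((n * i) * j) + s * i * j
  distrib = solve 5 (λ n f s i j → (n :* f :+ s) :* (i :* j) := f :* ((n :* i) :* j) :+ s :* i :* j) refl

monW-*-invFactProd : ∀ {k} (ω : Vec ℚ k) α → monW ω α * invFactProd α ≡ expMon ω α
monW-*-invFactProd []       []      = ℚP.*-identityˡ 1ℚ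
monW-*-invFactProd (w ∷ ws) (b ∷ β) = begin
  w ^ℚ b * monW ws β * invFactProd (b ∷ β)         ≡⟨ cong (w ^ℚ b * monW ws β *_) (invFactProd-∷ b β) ⟩
  w ^ℚ b * monW ws β * (1/! b * invFactProd β)     ≡⟨ ℚ*.interchange (w ^ℚ b) (monW ws β) (1/! b) (invFactProd β) ⟩
  w ^ℚ b * 1/! b * (monW ws β * invFactProd β)     ≡⟨ cong (w ^ℚ b * 1/! b *_) (monW-*-invFactProd ws β) ⟩
  expMon (w ∷ ws) (b ∷ β)                          ∎

expMon-zeros : ∀ {k} (c : Vec ℚ k) → expMon c (replicate _ 0) ≡ 1ℚ
expMon-zeros []       = refl
expMon-zeros (c ∷ cs) = trans (ℚP.*-identityˡ (expMon cs (replicate _ 0))) (expMon-zeros cs)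

expMon-size0 : ∀ {k} (c : Vec ℚ k) α → size α ≡ 0 → expMon c α ≡ 1ℚ
expMon-size0 []       []         _      = refl
expMon-size0 (c ∷ cs) (zero ∷ α) size≡0 = trans (ℚP.*-identityˡ (expMon cs α)) (expMon-size0 cs α size≡0)

𝟏 : ∀ {k} → Vec ℚ k
𝟏 = replicate _ 1ℚ

shift-expMon𝟏 : ∀ {k} (α : Exp k) → shift (expMon 𝟏) α ≡ ℕtoℚ (size α) * expMon 𝟏 α
shift-expMon𝟏 []          = sym (ℚP.*-zeroˡ 1ℚ)
shift-expMon𝟏 (zero ∷ α)  = begin
  shift (λ x → 1ℚ * expMon 𝟏 x) α          ≡⟨ shift-* 1ℚ (expMon 𝟏) α ⟩
  1ℚ * shift (expMon 𝟏) α                  ≡⟨ cong (1ℚ *_) (shift-expMon𝟏 α) ⟩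
  1ℚ * (ℕtoℚ (size α) * expMon 𝟏 α)        ≡⟨ ℚ*.x∙yz≈y∙xz 1ℚ (ℕtoℚ (size α)) (expMon 𝟏 α) ⟩
  ℕtoℚ (size α) * (1ℚ * expMon 𝟏 α)        ∎
shift-expMon𝟏 (suc a ∷ α) = begin
  expMon₁ 1ℚ a * expMon 𝟏 α + shift (λ x → c * expMon 𝟏 x) α
    ≡⟨ cong₂ _+_ (cong (_* expMon 𝟏 α) (trans (sym (ℚP.*-identityˡ (expMon₁ 1ℚ a))) (sym (expMon₁-suc 1ℚ a))))
                 (trans (shift-* c (expMon 𝟏) α) (cong (c *_) (shift-expMon𝟏 α))) ⟩
  ℕtoℚ (suc a) * c * expMon 𝟏 α + c * (ℕtoℚ (size α) * expMon 𝟏 α)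
    ≡⟨ collect (ℕtoℚ (suc a)) (ℕtoℚ (size α)) c (expMon 𝟏 α) ⟩
  (ℕtoℚ (suc a) + ℕtoℚ (size α)) * (c * expMon 𝟏 α)
    ≡⟨ cong (_* (c * expMon 𝟏 α)) (ℕtoℚ-homo-+ (suc a) (size α)) ⟨
  ℕtoℚ (suc a ℕ.+ size α) * (c * expMon 𝟏 α) ∎
  where
  c = expMon₁ 1ℚ (suc a)
  collect : ∀ n m c e → n * c * e + c * (m * e) ≡ (n + m) * (c * e)
  collect = solve 4 (λ n m c e → n :* c :* e :+ c :* (m :* e) := (n :+ m) :* (c :* e)) refl

δ-subst : ∀ m n (f : ℕ → ℚ) → δ m n * f m ≡ δ m n * f n
δ-subst m n f with m ℕ.≟ n
... | yes refl = refl
... | no  m≢n rewrite δ-≢ m≢n = trans (ℚP.*-zeroˡ (f m)) (sym (ℚP.*-zeroˡ (f n)))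

multinomial : ∀ {k} → ℕ → Exp k → ℚ
multinomial r x = δ (size x) r * (ℕtoℚ (r !) * expMon 𝟏 x)

shift-multinomial : ∀ {k} r (x : Exp k) → shift (multinomial r) x ≡ multinomial (suc r) x
shift-multinomial r x = begin
  shift (λ z → δ (size z) r * (ℕtoℚ (r !) * expMon 𝟏 z)) x
    ≡⟨ shift-*-size (λ n → δ n (suc r)) (λ z → ℕtoℚ (r !) * expMon 𝟏 z) x ⟩
  δ (size x) (suc r) * shift (λ z → ℕtoℚ (r !) * expMon 𝟏 z) x
    ≡⟨ cong (δ (size x) (suc r) *_) (trans (shift-* (ℕtoℚ (r !)) (expMon 𝟏) x) (cong (ℕtoℚ (r !) *_) (shift-expMon𝟏 x))) ⟩
  δ (size x) (suc r) * (ℕtoℚ (r !) * (ℕtoℚ (size x) * expMon 𝟏 x))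
    ≡⟨ δ-subst (size x) (suc r) (λ n → ℕtoℚ (r !) * (ℕtoℚ n * expMon 𝟏 x)) ⟩
  δ (size x) (suc r) * (ℕtoℚ (r !) * (ℕtoℚ (suc r) * expMon 𝟏 x))
    ≡⟨ cong (δ (size x) (suc r) *_) (trans (ℚ*.x∙yz≈yx∙z (ℕtoℚ (r !)) (ℕtoℚ (suc r)) (expMon 𝟏 x))
                                           (cong (_* expMon 𝟏 x) (sym (ℕtoℚ-homo-* (suc r) (r !))))) ⟩
  multinomial (suc r) x ∎

Dmon-*-invFactProd : ∀ {k} (ω : Vec ℚ k) r α →
                     Dmon ω r α * invFactProd α ≡ Σ₂ᵛ (λ x y → multinomial r x * expMon ω y) α
Dmon-*-invFactProd {k} ω zero α = begin
  Dmon ω 0 α * invFactProd α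
    ≡⟨ trans (cong (_* invFactProd α) (Dmon-zero ω α)) (monW-*-invFactProd ω α) ⟩
  expMon ω α
    ≡⟨ trans (cong (_* expMon ω α) (trans (ℚP.*-identityˡ (expMon 𝟏 (replicate k 0))) (expMon-zeros (𝟏 {k})))) (ℚP.*-identityˡ (expMon ω α)) ⟨
  1ℚ * expMon 𝟏 (replicate k 0) * expMon ω α
    ≡⟨ Σ₂ᵛ-δ-unit (λ x y → 1ℚ * expMon 𝟏 x * expMon ω y) α ⟨
  Σ₂ᵛ (λ x y → δ (size x) 0 * (1ℚ * expMon 𝟏 x * expMon ω y)) α
    ≡⟨ Σ₂ᵛ-cong α (λ x y → sym (ℚP.*-assoc (δ (size x) 0) (1ℚ * expMon 𝟏 x) (expMon ω y))) ⟩
  Σ₂ᵛ (λ x y → multinomial 0 x * expMon ω y) α ∎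
Dmon-*-invFactProd ω (suc r) α = begin
  Dmon ω (suc r) α * invFactProd α
    ≡⟨ cong (_* invFactProd α) (Dmon-suc ω r α) ⟩
  d1Sum (Dmon ω r) α * invFactProd α
    ≡⟨ d1Sum-*-invFactProd (Dmon ω r) α ⟩
  shift (λ β → Dmon ω r β * invFactProd β) α
    ≡⟨ shift-cong α (Dmon-*-invFactProd ω r) ⟩
  shift (λ β → Σ₂ᵛ (λ x y → multinomial r x * expMon ω y) β) α
    ≡⟨ shift-Σ₂ᵛ (multinomial r) (expMon ω) α ⟩
  Σ₂ᵛ (λ x y → shift (multinomial r) x * expMon ω y) α
    ≡⟨ Σ₂ᵛ-cong α (λ x y → cong (_* expMon ω y) (shift-multinomial r x)) ⟩
  Σ₂ᵛ (λ x y → multinomial (suc r) x * expMon ω y) α ∎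

Σ₂-δ-miss : ∀ n t (h : ℕ → ℕ → ℚ) → n < t → Σ₂ (λ i j → δ t j * h i j) n ≡ 0ℚ
Σ₂-δ-miss n t h n<t =
  trans (Σ₂-cong-on n (λ i j i+j≡n → cong (_* h i j) (δ-≢ (λ t≡j → ℕP.<-irrefl (sym t≡j) (j<t i j i+j≡n)))))
        (Σ₂-zero n (λ i j → ℚP.*-zeroˡ (h i j)))
  where
  j<t : ∀ i j → i ℕ.+ j ≡ n → j < t
  j<t i j i+j≡n = ℕP.≤-<-trans (subst (j ≤_) i+j≡n (ℕP.m≤n+m j i)) n<t

Σ₂-δ-hit : ∀ u t (h : ℕ → ℕ → ℚ) → Σ₂ (λ i j → δ t j * h i j) (u ℕ.+ t) ≡ h u t
Σ₂-δ-hit zero    zero    h = ℚP.*-identityˡ (h 0 0)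
Σ₂-δ-hit zero    (suc t) h =
  trans (cong₂ _+_ (trans (cong (_* h 0 (suc t)) (δ-refl t)) (ℚP.*-identityˡ (h 0 (suc t))))
                   (Σ₂-δ-miss t (suc t) (λ i → h (suc i)) (ℕP.n<1+n t)))
        (ℚP.+-identityʳ (h 0 (suc t)))
Σ₂-δ-hit (suc u) t       h =
  trans (cong (_+ Σ₂ (λ i j → δ t j * h (suc i) j) (u ℕ.+ t))
              (trans (cong (_* h 0 (suc (u ℕ.+ t))) (δ-≢ (ℕP.<⇒≢ (ℕ.s≤s (ℕP.m≤n+m t u))))) (ℚP.*-zeroˡ (h 0 (suc (u ℕ.+ t))))))
        (trans (ℚP.+-identityˡ _) (Σ₂-δ-hit u t (λ i → h (suc i))))

Σ₂-δ-binomial-B : ∀ q s u t → u ℕ.+ t ≡ suc s →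
                  Σ₂ (λ j r → δ t r * (ℕtoℚ (s C j) * B q j * ℕtoℚ (r !))) s ≡ hCoeff q u t
Σ₂-δ-binomial-B q s zero    .(suc s) refl =
  trans (Σ₂-δ-miss s (suc s) _ (ℕP.n<1+n s)) (sym (trans (cong (1ℚ *_) (0↑suc s)) (ℚP.*-zeroʳ 1ℚ)))
Σ₂-δ-binomial-B q .(u ℕ.+ t) (suc u) t refl = begin
  Σ₂ (λ j r → δ t r * (ℕtoℚ ((u ℕ.+ t) C j) * B q j * ℕtoℚ (r !))) (u ℕ.+ t)
    ≡⟨ Σ₂-δ-hit u t (λ j r → ℕtoℚ ((u ℕ.+ t) C j) * B q j * ℕtoℚ (r !)) ⟩
  ℕtoℚ ((u ℕ.+ t) C u) * B q u * ℕtoℚ (t !)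
    ≡⟨ ℚ*.xy∙z≈y∙xz (ℕtoℚ ((u ℕ.+ t) C u)) (B q u) (ℕtoℚ (t !)) ⟩
  B q u * (ℕtoℚ ((u ℕ.+ t) C u) * ℕtoℚ (t !))
    ≡⟨ cong₂ _*_ (B≡↓ q u) ([m+n]Cm*n!≡[1+m]↑n u t) ⟩
  hCoeff q (suc u) t ∎

Ĥ : ∀ {k} → Vec ℚ k → ℚ → PolyT k
Ĥ ω q = Φ ω 𝟏 (hCoeff q)

Ĥ-size0 : ∀ {k} (ω : Vec ℚ k) q α → size α ≡ 0 → Ĥ ω q α ≡ 1ℚ
Ĥ-size0 ω q α size≡0 = begin
  Ĥ ω q α                                               ≡⟨ Σ₂ᵛ-size0 _ α size≡0 ⟩
  hCoeff q (size α) (size α) * (expMon ω α * expMon 𝟏 α) ≡⟨ cong₂ _*_ (cong (λ n → hCoeff q n n) size≡0)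
                                                                      (cong₂ _*_ (expMon-size0 ω α size≡0) (expMon-size0 𝟏 α size≡0)) ⟩
  1ℚ * 1ℚ * (1ℚ * 1ℚ)                                   ≡⟨ refl ⟩
  1ℚ                                                    ∎

innerCoeff≡Ĥ : ∀ {k} (ω : Vec ℚ k) q α s → size α ≡ suc s → innerCoeff ω q α ≡ Ĥ ω q α
innerCoeff≡Ĥ ω q α s size≡1+s = begin
  innerCoeff ω q α
    ≡⟨ cong (λ n → sumMap (λ j → invFactProd α * ℕtoℚ ((n ∸ 1) C j) * B q j * Dmon ω (n ∸ j ∸ 1) α) (upTo n)) size≡1+s ⟩
  sumMap (λ j → invFactProd α * ℕtoℚ (s C j) * B q j * Dmon ω (suc s ∸ j ∸ 1) α) (upTo (suc s))
    ≡⟨ sumMap-cong (upTo (suc s)) (λ j → cong (λ r → invFactProd α * ℕtoℚ (s C j) * B q j * Dmon ω r α)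
                                              (trans (ℕP.∸-+-assoc (suc s) j 1) (cong (suc s ∸_) (ℕP.+-comm j 1)))) ⟩
  sumMap (λ j → invFactProd α * ℕtoℚ (s C j) * B q j * Dmon ω (s ∸ j) α) (upTo (suc s))
    ≡⟨ sumMap-upTo≡Σ₂ (λ j r → invFactProd α * ℕtoℚ (s C j) * B q j * Dmon ω r α) s ⟩
  Σ₂ (λ j r → invFactProd α * ℕtoℚ (s C j) * B q j * Dmon ω r α) s
    ≡⟨ Σ₂-cong s (λ j r → trans (reassoc (invFactProd α) (ℕtoℚ (s C j)) (B q j) (Dmon ω r α))
                               (trans (cong (ℕtoℚ (s C j) * B q j *_) (Dmon-*-invFactProd ω r α))
                                      (*-distribˡ-Σ₂ᵛ (ℕtoℚ (s C j) * B q j) _ α))) ⟩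
  Σ₂ (λ j r → Σ₂ᵛ (λ x y → ℕtoℚ (s C j) * B q j * (multinomial r x * expMon ω y)) α) s
    ≡⟨ Σ₂ᵛ-Σ₂ (λ j r x y → ℕtoℚ (s C j) * B q j * (multinomial r x * expMon ω y)) s α ⟨
  Σ₂ᵛ (λ x y → Σ₂ (λ j r → ℕtoℚ (s C j) * B q j * (multinomial r x * expMon ω y)) s) α
    ≡⟨ Σ₂ᵛ-cong-on α (λ x y x+y≡α → collapse x y (trans (ℕP.+-comm (size y) (size x))
                                                      (trans (sym (size-zipWith-+ x y)) (trans (cong size x+y≡α) size≡1+s)))) ⟩
  Σ₂ᵛ (λ x y → hCoeff q (size y) (size x) * (expMon ω y * expMon 𝟏 x)) α
    ≡⟨ Σ₂ᵛ-swap _ α ⟩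
  Ĥ ω q α ∎
  where
  reassoc : ∀ i c b d → i * c * b * d ≡ c * b * (d * i)
  reassoc = solve 4 (λ i c b d → i :* c :* b :* d := c :* b :* (d :* i)) refl
  collapse : ∀ x y → size y ℕ.+ size x ≡ suc s →
    Σ₂ (λ j r → ℕtoℚ (s C j) * B q j * (multinomial r x * expMon ω y)) s ≡ hCoeff q (size y) (size x) * (expMon ω y * expMon 𝟏 x)
  collapse x y sizes = begin
    Σ₂ (λ j r → ℕtoℚ (s C j) * B q j * (multinomial r x * expMon ω y)) s
      ≡⟨ Σ₂-cong s (λ j r → reassoc′ (ℕtoℚ (s C j) * B q j) (δ (size x) r) (ℕtoℚ (r !)) (expMon 𝟏 x) (expMon ω y)) ⟩
    Σ₂ (λ j r → δ (size x) r * (ℕtoℚ (s C j) * B q j * ℕtoℚ (r !)) * (expMon ω y * expMon 𝟏 x)) s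
      ≡⟨ *-distribʳ-Σ₂ (expMon ω y * expMon 𝟏 x) (λ j r → δ (size x) r * (ℕtoℚ (s C j) * B q j * ℕtoℚ (r !))) s ⟨
    Σ₂ (λ j r → δ (size x) r * (ℕtoℚ (s C j) * B q j * ℕtoℚ (r !))) s * (expMon ω y * expMon 𝟏 x)
      ≡⟨ cong (_* (expMon ω y * expMon 𝟏 x)) (Σ₂-δ-binomial-B q s (size y) (size x) sizes) ⟩
    hCoeff q (size y) (size x) * (expMon ω y * expMon 𝟏 x) ∎
    where
    reassoc′ : ∀ c d f e w → c * (d * (f * e) * w) ≡ d * (c * f) * (w * e)
    reassoc′ = solve 5 (λ c d f e w → c :* (d :* (f :* e) :* w) := d :* (c :* f) :* (w :* e)) refl

Ĥ-⊛ : ∀ {k} (ω : Vec ℚ k) q q′ γ → (Ĥ ω q ⊛ Ĥ ω q′) γ ≡ Ĥ ω (q + q′) γ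
Ĥ-⊛ ω q q′ γ = trans (Φ-⊛ ω 𝟏 (hCoeff q) (hCoeff q′) γ) (Φ-cong ω 𝟏 (hCoeff-⋆ q q′) γ)

-- Grading by weight

weightFrom-size0 : ∀ {k} m (α : Exp k) → size α ≡ 0 → weightFrom m α ≡ 0
weightFrom-size0 m []         _      = refl
weightFrom-size0 m (zero ∷ α) size≡0 = trans (cong (ℕ._+ weightFrom (suc m) α) (ℕP.*-zeroʳ m)) (weightFrom-size0 (suc m) α size≡0)

weightFrom-suc≡0⇒size0 : ∀ {k} m (α : Exp k) → weightFrom (suc m) α ≡ 0 → size α ≡ 0
weightFrom-suc≡0⇒size0 m []         _   = refl
weightFrom-suc≡0⇒size0 m (zero ∷ α) w≡0 =
  weightFrom-suc≡0⇒size0 (suc m) α (trans (cong (ℕ._+ weightFrom (suc (suc m)) α) (sym (ℕP.*-zeroʳ (suc m)))) w≡0)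

if≡ᵇ-then-else-0 : ∀ m n {x y : ℚ} → (m ≡ n → x ≡ y) → (if m ≡ᵇ n then x else 0ℚ) ≡ δ m n * y
if≡ᵇ-then-else-0 m n {x} {y} m≡n⇒x≡y with m ≡ᵇ n in m≡ᵇn
... | true  = trans (m≡n⇒x≡y (ℕP.≡ᵇ⇒≡ m n (subst T (sym m≡ᵇn) tt))) (sym (ℚP.*-identityˡ y))
... | false = sym (ℚP.*-zeroˡ y)

H-graded : ∀ {k} (ω : Vec ℚ k) q n α → H ω q n α ≡ δ (weight α) n * Ĥ ω q α
H-graded ω q zero    α = if≡ᵇ-then-else-0 (weight α) 0 (λ w≡0 → sym (Ĥ-size0 ω q α (weightFrom-suc≡0⇒size0 0 α w≡0)))
H-graded ω q (suc n) α = if≡ᵇ-then-else-0 (weight α) (suc n) (λ w≡1+n → by-size w≡1+n (size α) refl)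
  where
  by-size : weight α ≡ suc n → ∀ m → size α ≡ m → innerCoeff ω q α ≡ Ĥ ω q α
  by-size w≡1+n zero    size≡0   = ⊥-elim (ℕP.0≢1+n (trans (sym (weightFrom-size0 1 α size≡0)) w≡1+n))
  by-size w≡1+n (suc s) size≡1+s = innerCoeff≡Ĥ ω q α s size≡1+s

Σ₂-δ-δ : ∀ n w₁ w₂ → Σ₂ (λ i j → δ w₁ i * δ w₂ j) n ≡ δ (w₁ ℕ.+ w₂) n
Σ₂-δ-δ zero    zero     w₂ = ℚP.*-identityˡ (δ w₂ 0)
Σ₂-δ-δ zero    (suc w₁) w₂ = ℚP.*-zeroˡ (δ w₂ 0)
Σ₂-δ-δ (suc n) zero     w₂ =
  trans (cong₂ _+_ (ℚP.*-identityˡ (δ w₂ (suc n))) (Σ₂-zero n (λ i j → ℚP.*-zeroˡ (δ w₂ j)))) (ℚP.+-identityʳ (δ w₂ (suc n)))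
Σ₂-δ-δ (suc n) (suc w₁) w₂ =
  trans (cong₂ _+_ (ℚP.*-zeroˡ (δ w₂ (suc n))) (Σ₂-δ-δ n w₁ w₂)) (ℚP.+-identityˡ (δ (w₁ ℕ.+ w₂) n))

levelProd-graded : ∀ {k} {P Q : ℕ → PolyT k} {P̂ Q̂ : PolyT k} →
  (∀ i x → P i x ≡ δ (weight x) i * P̂ x) → (∀ j y → Q j y ≡ δ (weight y) j * Q̂ y) →
  ∀ n γ → levelProd P Q n γ ≡ δ (weight γ) n * (P̂ ⊛ Q̂) γ
levelProd-graded {P = P} {Q} {P̂} {Q̂} P-graded Q-graded n γ = begin
  levelProd P Q n γ
    ≡⟨ sumMap-upTo≡Σ₂ (λ i j → (P i ⊛ Q j) γ) n ⟩
  Σ₂ (λ i j → (P i ⊛ Q j) γ) n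
    ≡⟨ Σ₂-cong n (λ i j → ⊛≡Σ₂ᵛ (P i) (Q j) γ) ⟩
  Σ₂ (λ i j → Σ₂ᵛ (λ x y → P i x * Q j y) γ) n
    ≡⟨ Σ₂ᵛ-Σ₂ (λ i j x y → P i x * Q j y) n γ ⟨
  Σ₂ᵛ (λ x y → Σ₂ (λ i j → P i x * Q j y) n) γ
    ≡⟨ Σ₂ᵛ-cong-on γ levels ⟩
  Σ₂ᵛ (λ x y → δ (weight γ) n * (P̂ x * Q̂ y)) γ
    ≡⟨ *-distribˡ-Σ₂ᵛ (δ (weight γ) n) (λ x y → P̂ x * Q̂ y) γ ⟨
  δ (weight γ) n * Σ₂ᵛ (λ x y → P̂ x * Q̂ y) γ
    ≡⟨ cong (δ (weight γ) n *_) (⊛≡Σ₂ᵛ P̂ Q̂ γ) ⟨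
  δ (weight γ) n * (P̂ ⊛ Q̂) γ ∎
  where
  levels : ∀ x y → zipWith ℕ._+_ x y ≡ γ → Σ₂ (λ i j → P i x * Q j y) n ≡ δ (weight γ) n * (P̂ x * Q̂ y)
  levels x y x+y≡γ = begin
    Σ₂ (λ i j → P i x * Q j y) n
      ≡⟨ Σ₂-cong n (λ i j → trans (cong₂ _*_ (P-graded i x) (Q-graded j y)) (ℚ*.interchange (δ (weight x) i) (P̂ x) (δ (weight y) j) (Q̂ y))) ⟩
    Σ₂ (λ i j → δ (weight x) i * δ (weight y) j * (P̂ x * Q̂ y)) n
      ≡⟨ *-distribʳ-Σ₂ (P̂ x * Q̂ y) (λ i j → δ (weight x) i * δ (weight y) j) n ⟨
    Σ₂ (λ i j → δ (weight x) i * δ (weight y) j) n * (P̂ x * Q̂ y)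
      ≡⟨ cong (_* (P̂ x * Q̂ y)) (Σ₂-δ-δ n (weight x) (weight y)) ⟩
    δ (weight x ℕ.+ weight y) n * (P̂ x * Q̂ y)
      ≡⟨ cong (λ w → δ w n * (P̂ x * Q̂ y)) (trans (sym (weightFrom-zipWith-+ 1 x y)) (cong weight x+y≡γ)) ⟩
    δ (weight γ) n * (P̂ x * Q̂ y) ∎

theorem12 : (k : ℕ) → 1 ≤ k → (ω : Vec ℚ k) (q q' : ℚ) (n : ℕ) (γ : Exp k) →
    levelProd (H ω q) (H ω q') n γ ≡ H ω (q + q') n γ
theorem12 k _ ω q q′ n γ = begin
  levelProd (H ω q) (H ω q′) n γ      ≡⟨ levelProd-graded (H-graded ω q) (H-graded ω q′) n γ ⟩
  δ (weight γ) n * (Ĥ ω q ⊛ Ĥ ω q′) γ ≡⟨ cong (δ (weight γ) n *_) (Ĥ-⊛ ω q q′ γ) ⟩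
  δ (weight γ) n * Ĥ ω (q + q′) γ     ≡⟨ H-graded ω (q + q′) n γ ⟨
  H ω (q + q′) n γ                    ∎
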